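{- For every partition $\lambda$, the map $\xi_\lambda:\mathrm{SRT}_\lambda\to\mathrm{THC}^{\ge0}_\lambda$ is a bijection, and for all $R\in\mathrm{SRT}_\lambda$ we have $\Gamma(R)=\Delta(\xi_\lambda(R))$.
   Context: For a partition $\lambda=(\lambda_1\ge\dots\ge\lambda_\ell>0)$, its Ferrers diagram is the set of cells $(i,j)$, $1\le i\le\ell$, $1\le j\le\lambda_i$ (row $i$ from the top). A rim hook is a connected skew diagram (difference of two Ferrers diagrams of partitions) containing no $2\times2$ square. A special rim hook tableau (SRT) of shape $\lambda$ is a partition of the diagram of $\lambda$ into rim hooks each containing a cell of the first column; $\mathrm{SRT}_\lambda$ is the set of these. The initial cell of a rim hook is its northeastern-most cell; the terminal cell is its southwestern-most cell. The $d$-th diagonal is $\mathcal L_d=\{(d+k,1+k):k\in\mathbb Z\}$; each diagonal contains at most one initial cell of an SRT. $\operatorname{perm}_{\mathrm{SRT}}(R)=\sigma\in S_\ell$ is defined for $i\in[\ell]$ by: if $\mathcal L_{i-\lambda_i+1}$ contains no initial cell, $\sigma_i=i-\lambda_i$; otherwise $\sigma_i$ is the row of the terminal cell of the rim hook whose initial cell lies in $\mathcal L_{i-\lambda_i+1}$. $\Gamma(R)=(\Gamma_1(R),\dots,\Gamma_\ell(R))$, where $\Gamma_i(R)$ is the number of cells of the rim hook whose initial cell lies on $\mathcal L_{i-\lambda_i+1}$, or $0$ if there is none. Tunnel hook coverings (THCs), introduced by Allen and Mason; only these facts are needed: for a composition $\gamma=(\gamma_1,\dots,\gamma_\ell)$,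 each THC $T$ of shape $\gamma$ has a permutation $\operatorname{perm}(T)\in S_\ell$, and $T\mapsto\operatorname{perm}(T)$ is a bijection from THCs of shape $\gamma$ onto $S_\ell$; $\Delta(T)=(\Delta_1(T),\dots,\Delta_\ell(T))$ with $\Delta_i(T)=\gamma_i+\sigma_i-i$ for $\sigma=\operatorname{perm}(T)$. $\mathrm{THC}^{\ge0}_\lambda$ is the set of THCs $T$ of shape $\lambda$ with $\Delta_i(T)\ge0$ for all $i\in[\ell]$. $\xi_\lambda(R)$ is the unique THC of shape $\lambda$ with $\operatorname{perm}(\xi_\lambda(R))=\operatorname{perm}_{\mathrm{SRT}}(R)$. -}

module Defs where

open import Data.Nat using (ℕ; zero; suc; _≤_; _≥_; _≟_)
open import Data.Integer as ℤ using (ℤ; +_)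
open import Data.Product using (Σ; _×_; _,_; proj₁; proj₂)
open import Data.Sum using (_⊎_)
open import Data.List using (List; []; _∷_; length; map; upTo; concatMap; filter)
open import Data.List.Relation.Unary.All using (All)
open import Data.List.Relation.Unary.Linked using (Linked)
open import Data.List.Relation.Binary.Permutation.Propositional using (_↭_)
open import Relation.Nullary using (¬_)
open import Relation.Binary.PropositionalEquality using (_≡_)

-- 1-based lookup: la ‼ i = λ_i for 1 ≤ i ≤ ℓ, and 0 otherwise.
_‼_ : List ℕ → ℕ → ℕ
[] ‼ _ = 0
(x ∷ xs) ‼ zero = 0
(x ∷ xs) ‼ suc zero = x
(x ∷ xs) ‼ suc (suc n) = xs ‼ suc n

IsPartition : List ℕ → Set
IsPartition la = All (λ x → 1 ≤ x) la × Linked _≥_ la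

-- cells (row , column), 1-based, row i counted from the top
Cell : Set
Cell = ℕ × ℕ

row col : Cell → ℕ
row = proj₁
col = proj₂

InDiagram : List ℕ → Cell → Set
InDiagram la (i , j) = 1 ≤ i × 1 ≤ j × j ≤ la ‼ i

cells : List ℕ → List Cell
cells la = concatMap (λ i → map (λ j → (i , suc j)) (upTo (la ‼ i)))
                     (map suc (upTo (length la)))

CellSet : Set₁
CellSet = Cell → Set

IsSkew : CellSet → Set
IsSkew H = Σ (List ℕ) λ mu → Σ (List ℕ) λ nu →
  IsPartition mu × IsPartition nu ×
  (∀ c → InDiagram nu c → InDiagram mu c) ×
  (∀ c → (H c → InDiagram mu c × ¬ InDiagram nu c) ×
         (InDiagram mu c × ¬ InDiagram nu c → H c))

Adjacent : Cell → Cell → Set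
Adjacent (i , j) (i' , j') =
  (i ≡ i' × (suc j ≡ j' ⊎ suc j' ≡ j)) ⊎ (j ≡ j' × (suc i ≡ i' ⊎ suc i' ≡ i))

data Path (H : CellSet) : Cell → Cell → Set where
  here : ∀ {c} → H c → Path H c c
  step : ∀ {c d e} → H c → Adjacent c d → Path H d e → Path H c e

Connected : CellSet → Set
Connected H = Σ Cell H × (∀ c d → H c → H d → Path H c d)

No2x2 : CellSet → Set
No2x2 H = ∀ i j → ¬ (H (i , j) × H (suc i , j) × H (i , suc j) × H (suc i , suc j))

IsRimHook : CellSet → Set
IsRimHook H = IsSkew H × Connected H × No2x2 H

Initial : CellSet → Cell → Set
Initial H c = H c × (∀ d → H d → row c ≤ row d × col d ≤ col c)

Terminal : CellSet → Cell → Set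
Terminal H c = H c × (∀ d → H d → row d ≤ row c × col c ≤ col d)

-- A partition of the diagram into blocks is encoded by a labelling of
-- cells; the blocks are the nonempty fibres of the labelling on the
-- diagram.  Two labellings give the same SRT iff they induce the same
-- set partition (SamePartition).

Block : List ℕ → (Cell → ℕ) → ℕ → CellSet
Block la lab a c = InDiagram la c × lab c ≡ a

record SRT (la : List ℕ) : Set where
  field
    label : Cell → ℕ
    hooks : ∀ c → InDiagram la c →
      IsRimHook (Block la label (label c)) ×
      Σ ℕ (λ r → Block la label (label c) (r , 1))
open SRT public

hookOf : ∀ {la} → SRT la → Cell → CellSet
hookOf {la} R c = Block la (label R) (label R c)

SamePartition : ∀ {la} → SRT la → SRT la → Set
SamePartition {la} R R' = ∀ c d → InDiagram la c → InDiagram la d →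
  (label R c ≡ label R d → label R' c ≡ label R' d) ×
  (label R' c ≡ label R' d → label R c ≡ label R d)

hookSize : ∀ {la} → SRT la → Cell → ℕ
hookSize {la} R c = length (filter (λ d → label R d ≟ label R c) (cells la))

-- Diagonals: L_d = {(d+k, 1+k)}, i.e. (r , k) ∈ L_d iff r - k + 1 = d

OnDiag : ℤ → Cell → Set
OnDiag d (r , k) = (+ r ℤ.- + k) ℤ.+ ℤ.1ℤ ≡ d

diagOf : List ℕ → ℕ → ℤ
diagOf la i = (+ i ℤ.- + (la ‼ i)) ℤ.+ ℤ.1ℤ

InitialOnRow : ∀ {la} → SRT la → ℕ → Cell → Set
InitialOnRow {la} R i c =
  InDiagram la c × Initial (hookOf R c) c × OnDiag (diagOf la i) c

-- perm_SRT(R) = σ (σ in one-line notation as a list, σ_i = σ ‼ i)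

PermSRT : ∀ {la} → SRT la → List ℕ → Set
PermSRT {la} R σ = ∀ i → 1 ≤ i → i ≤ length la →
  ((∀ c → ¬ InitialOnRow R i c) → + (σ ‼ i) ≡ + i ℤ.- + (la ‼ i)) ×
  (∀ c t → InitialOnRow R i c → Terminal (hookOf R c) t → σ ‼ i ≡ row t)

GammaIs : ∀ {la} → SRT la → ℕ → ℤ → Set
GammaIs {la} R i g =
  ((∀ c → ¬ InitialOnRow R i c) → g ≡ ℤ.0ℤ) ×
  (∀ c → InitialOnRow R i c → g ≡ + hookSize R c)

IsPerm : ℕ → List ℕ → Set
IsPerm n σ = σ ↭ map suc (upTo n)

-- Δ_i(T) = λ_i + σ_i - i for the THC T of shape λ with perm(T) = σ
Δ : List ℕ → List ℕ → ℕ → ℤ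
Δ la σ i = (+ (la ‼ i) ℤ.+ + (σ ‼ i)) ℤ.- + i

-- perm(T) = σ with T ∈ THC^{≥0}_λ
NonNegΔ : List ℕ → List ℕ → Set
NonNegΔ la σ = ∀ i → 1 ≤ i → i ≤ length la → ℤ.0ℤ ℤ.≤ Δ la σ i

-- Induction on the number ℓ of rows.  In an SRT, the hook through the corner (ℓ , 1) cannot be
-- crossed by another hook reaching the first column further down, so it is the outer rim of
-- rows t … ℓ for some t: its initial cell (t , λ_t) lies on the diagonal of row t, its terminal
-- cell is (ℓ , 1), and it has λ_t + ℓ - t = Δ_t cells.  Removing it leaves an SRT R' of the shape
-- μ with μ_i = λ_i for i < t and μ_i = λ_(i+1) - 1 for i ≥ t, and row i' of μ lies on the
-- diagonal of row i of λ (i' = i above t, i' = i - 1 below).  Hence perm_SRT(R) is perm_SRT(R')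
-- with ℓ inserted at position t, and Γ and Δ are inherited row by row.  Conversely, for σ with
-- Δ(σ) ≥ 0 the position of ℓ determines t, and R is rebuilt from an SRT for σ with ℓ deleted.
-- Since T ↦ perm(T) is a bijection onto S_ℓ, this is the bijectivity of ξ_λ.
module Submission where

open import Defs
open import Data.Nat
open import Data.Nat.Properties
open import Data.Integer as ℤ using (ℤ; +_)
import Data.Integer.Properties as ℤ
import Data.Integer.Tactic.RingSolver as ℤ-Solver
open import Data.Product using (Σ; _×_; _,_; proj₁; proj₂)
open import Data.Sum using (_⊎_; inj₁; inj₂)
open import Data.Empty using (⊥; ⊥-elim)
open import Data.List using (List; []; _∷_; [_]; _++_; length; map; upTo; concatMap; filter; take; drop)
open import Data.List.Properties using (upTo-∷ʳ; map-++; concatMap-++; filter-++; length-++; length-map; length-upTo; length-take; take++drop≡id; ++-identityʳ)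
open import Data.List.Membership.Propositional using (_∈_)
open import Data.List.Membership.Propositional.Properties using (∈-∃++; ∈-map⁻; ∈-map⁺; ∈-upTo⁻; ∈-upTo⁺)
open import Data.List.Relation.Unary.Any using (here; there)
open import Data.List.Relation.Binary.Permutation.Propositional using (_↭_; ↭-refl; ↭-sym; ↭-trans; prep; ↭-reflexive)
open import Data.List.Relation.Binary.Permutation.Propositional.Properties using (∈-resp-↭; ↭-length; shift; drop-mid; ++-comm)
open import Data.List.Relation.Unary.All using (All; []; _∷_)
open import Data.List.Relation.Unary.Linked as Linked using (Linked; []; [-]; _∷_)
open import Relation.Nullary using (¬_; Dec; yes; no)
open import Relation.Nullary.Decidable using (_×-dec_; decidable-stable)
open import Relation.Unary using (_⊆_; _≐_)
open import Relation.Unary.Properties using (≐-sym)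
import Relation.Unary as U
open import Relation.Binary.Definitions using (tri<; tri≈; tri>)
open import Relation.Binary.PropositionalEquality hiding ([_])

-- Shapes

-- Row lengths of a diagram with n rows, the last ones possibly empty
-- (removing a hook can empty a row).
record Shape (s : ℕ → ℕ) (n : ℕ) : Set where
  field
    antitone : ∀ {i j} → 1 ≤ i → i ≤ j → s j ≤ s i
    vanishes : ∀ {i} → n < i → s i ≡ 0
open Shape public

‼-suc-antitone : ∀ {xs} → Linked _≥_ xs → ∀ i → xs ‼ suc (suc i) ≤ xs ‼ suc i
‼-suc-antitone {[]} _ i = z≤n
‼-suc-antitone {x ∷ []} _ zero = z≤n
‼-suc-antitone {x ∷ []} _ (suc i) = z≤n
‼-suc-antitone {x ∷ y ∷ xs} (x≥y ∷ _) zero = x≥y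
‼-suc-antitone {x ∷ y ∷ xs} (_ ∷ l) (suc i) = ‼-suc-antitone l i

‼-antitone : ∀ {xs} → Linked _≥_ xs → ∀ {i j} → 1 ≤ i → i ≤ j → xs ‼ j ≤ xs ‼ i
‼-antitone {xs} l {suc i} _ (s≤s i≤j) = go i≤j
  where
    go : ∀ {j} → i ≤ j → xs ‼ suc j ≤ xs ‼ suc i
    go {zero} z≤n = ≤-refl
    go {suc j} i≤1+j with m≤n⇒m<n∨m≡n i≤1+j
    ... | inj₂ refl = ≤-refl
    ... | inj₁ (s≤s i≤j) = ≤-trans (‼-suc-antitone l j) (go i≤j)

‼-beyond : ∀ xs {i} → length xs < i → xs ‼ i ≡ 0
‼-beyond [] _ = refl
‼-beyond (x ∷ []) {suc zero} (s≤s ())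
‼-beyond (x ∷ []) {suc (suc i)} _ = refl
‼-beyond (x ∷ y ∷ xs) {suc zero} (s≤s ())
‼-beyond (x ∷ y ∷ xs) {suc (suc i)} (s≤s 1+l<1+i) = ‼-beyond (y ∷ xs) 1+l<1+i

partition-shape : ∀ {la} → IsPartition la → Shape (la ‼_) (length la)
partition-shape {la} (_ , linked) = record { antitone = ‼-antitone linked ; vanishes = ‼-beyond la }

Shape-shift : ∀ {f m} → Shape f (suc m) → Shape (λ i → f (suc i)) m
Shape-shift sh = record { antitone = λ _ i≤j → antitone sh (s≤s z≤n) (s≤s i≤j)
                        ; vanishes = λ m<i → vanishes sh (s≤s m<i) }

Shape-weaken : ∀ {s n} → Shape s n → Shape s (suc n)
Shape-weaken sh = record { antitone = antitone sh ; vanishes = λ n+1<i → vanishes sh (<⇒≤ n+1<i) }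

rowsToList : (ℕ → ℕ) → ℕ → List ℕ
rowsToList f zero = []
rowsToList f (suc m) with f 1
... | zero = []
... | suc x = suc x ∷ rowsToList (λ i → f (suc i)) m

rowsToList-‼ : ∀ {f} m → Shape f m → ∀ {i} → 1 ≤ i → rowsToList f m ‼ i ≡ f i
rowsToList-‼ zero sh {i} 1≤i = sym (vanishes sh 1≤i)
rowsToList-‼ {f} (suc m) sh {i} 1≤i with f 1 in f1≡
... | zero = sym (n≤0⇒n≡0 (subst (f i ≤_) f1≡ (antitone sh ≤-refl 1≤i)))
rowsToList-‼ {f} (suc m) sh {suc zero} 1≤i | suc x = sym f1≡
rowsToList-‼ {f} (suc m) sh {suc (suc i)} 1≤i | suc x = rowsToList-‼ m (Shape-shift sh) (s≤s z≤n)

private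
  rowsToList-linked-below : ∀ {f} m → Shape f m → ∀ b → f 1 ≤ b → Linked _≥_ (b ∷ rowsToList f m)
  rowsToList-linked-below zero sh b _ = [-]
  rowsToList-linked-below {f} (suc m) sh b f1≤b with f 1 in f1≡
  ... | zero = [-]
  ... | suc x = f1≤b ∷ rowsToList-linked-below m (Shape-shift sh) (suc x)
                         (subst (f 2 ≤_) f1≡ (antitone sh ≤-refl (s≤s z≤n)))

  rowsToList-positive : ∀ f m → All (1 ≤_) (rowsToList f m)
  rowsToList-positive f zero = []
  rowsToList-positive f (suc m) with f 1
  ... | zero = []
  ... | suc x = s≤s z≤n ∷ rowsToList-positive (λ i → f (suc i)) m

rowsToList-partition : ∀ {f m} → Shape f m → IsPartition (rowsToList f m)
rowsToList-partition {f} {m} sh =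
  rowsToList-positive f m , Linked.tail (rowsToList-linked-below m sh (f 1) ≤-refl)

-- The notions of Defs with the partition la replaced by its row-length function
-- s = la ‼_ and ℓ = length la by a bound n.  At s = la ‼_ and n = length la they
-- unfold to the originals, so the induction may pass through shapes with empty rows.
InDiagramᶠ : (ℕ → ℕ) → Cell → Set
InDiagramᶠ s (i , j) = 1 ≤ i × 1 ≤ j × j ≤ s i

Blockᶠ : (ℕ → ℕ) → (Cell → ℕ) → ℕ → CellSet
Blockᶠ s lab a c = InDiagramᶠ s c × lab c ≡ a

record SRTᶠ (s : ℕ → ℕ) : Set where
  field
    labelᶠ : Cell → ℕ
    hooksᶠ : ∀ c → InDiagramᶠ s c →
      IsRimHook (Blockᶠ s labelᶠ (labelᶠ c)) ×
      Σ ℕ (λ r → Blockᶠ s labelᶠ (labelᶠ c) (r , 1))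
open SRTᶠ public

hookOfᶠ : ∀ {s} → SRTᶠ s → Cell → CellSet
hookOfᶠ {s} R c = Blockᶠ s (labelᶠ R) (labelᶠ R c)

diagOfᶠ : (ℕ → ℕ) → ℕ → ℤ
diagOfᶠ s i = (+ i ℤ.- + (s i)) ℤ.+ ℤ.1ℤ

InitialOnRowᶠ : ∀ {s} → SRTᶠ s → ℕ → Cell → Set
InitialOnRowᶠ {s} R i c = InDiagramᶠ s c × Initial (hookOfᶠ R c) c × OnDiag (diagOfᶠ s i) c

cellsᶠ : (ℕ → ℕ) → ℕ → List Cell
cellsᶠ s n = concatMap (λ i → map (λ j → (i , suc j)) (upTo (s i))) (map suc (upTo n))

hookSizeᶠ : ∀ {s} → ℕ → SRTᶠ s → Cell → ℕ
hookSizeᶠ {s} n R c = length (filter (λ d → labelᶠ R d ≟ labelᶠ R c) (cellsᶠ s n))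

PermRowᶠ : ∀ {s} → SRTᶠ s → List ℕ → ℕ → Set
PermRowᶠ {s} R σ i =
  ((∀ c → ¬ InitialOnRowᶠ R i c) → + (σ ‼ i) ≡ + i ℤ.- + (s i)) ×
  (∀ c t → InitialOnRowᶠ R i c → Terminal (hookOfᶠ R c) t → σ ‼ i ≡ row t)

PermSRTᶠ : ∀ {s} → ℕ → SRTᶠ s → List ℕ → Set
PermSRTᶠ n R σ = ∀ i → 1 ≤ i → i ≤ n → PermRowᶠ R σ i

GammaIsᶠ : ∀ {s} → ℕ → SRTᶠ s → ℕ → ℤ → Set
GammaIsᶠ {s} n R i g =
  ((∀ c → ¬ InitialOnRowᶠ R i c) → g ≡ ℤ.0ℤ) ×
  (∀ c → InitialOnRowᶠ R i c → g ≡ + hookSizeᶠ n R c)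

Δᶠ : (ℕ → ℕ) → List ℕ → ℕ → ℤ
Δᶠ s σ i = (+ (s i) ℤ.+ + (σ ‼ i)) ℤ.- + i

GammaΔᶠ : ∀ {s} → ℕ → SRTᶠ s → List ℕ → Set
GammaΔᶠ {s} n R σ = ∀ i → 1 ≤ i → i ≤ n → GammaIsᶠ n R i (Δᶠ s σ i)

NonNegΔᶠ : (ℕ → ℕ) → ℕ → List ℕ → Set
NonNegΔᶠ s n σ = ∀ i → 1 ≤ i → i ≤ n → ℤ.0ℤ ℤ.≤ Δᶠ s σ i

SamePartitionᶠ : ∀ {s} → SRTᶠ s → SRTᶠ s → Set
SamePartitionᶠ {s} R R' = ∀ c d → InDiagramᶠ s c → InDiagramᶠ s d →
  (labelᶠ R c ≡ labelᶠ R d → labelᶠ R' c ≡ labelᶠ R' d) ×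
  (labelᶠ R' c ≡ labelᶠ R' d → labelᶠ R c ≡ labelᶠ R d)

toSRTᶠ : ∀ {la} → SRT la → SRTᶠ (la ‼_)
toSRTᶠ R = record { labelᶠ = label R ; hooksᶠ = hooks R }

fromSRTᶠ : ∀ {la} → SRTᶠ (la ‼_) → SRT la
fromSRTᶠ R = record { label = labelᶠ R ; hooks = hooksᶠ R }

InDiagramᶠ? : ∀ s c → Dec (InDiagramᶠ s c)
InDiagramᶠ? s (i , j) = (1 ≤? i) ×-dec ((1 ≤? j) ×-dec (j ≤? s i))

rowsToList-diagram : ∀ {f m} → Shape f m → InDiagram (rowsToList f m) ≐ InDiagramᶠ f
rowsToList-diagram {m = m} sh =
  (λ { {i , j} (1≤i , 1≤j , j≤) → 1≤i , 1≤j , subst (j ≤_) (rowsToList-‼ m sh 1≤i) j≤ }) ,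
  (λ { {i , j} (1≤i , 1≤j , j≤) → 1≤i , 1≤j , subst (j ≤_) (sym (rowsToList-‼ m sh 1≤i)) j≤ })

row≤bound : ∀ {s n} → Shape s n → ∀ {i j} → InDiagramᶠ s (i , j) → i ≤ n
row≤bound {s} {n} sh {i} {j} (_ , 1≤j , j≤si) with i ≤? n
... | yes i≤n = i≤n
... | no i≰n = ⊥-elim (<⇒≱ 1≤j (subst (j ≤_) (vanishes sh (≰⇒> i≰n)) j≤si))

Initial-resp-≐ : ∀ {H H' c} → H ≐ H' → Initial H c → Initial H' c
Initial-resp-≐ (H⊆H' , H'⊆H) (hc , extreme) = H⊆H' hc , λ d h'd → extreme d (H'⊆H h'd)

Terminal-resp-≐ : ∀ {H H' c} → H ≐ H' → Terminal H c → Terminal H' c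
Terminal-resp-≐ (H⊆H' , H'⊆H) (hc , extreme) = H⊆H' hc , λ d h'd → extreme d (H'⊆H h'd)

InitialCellsOnDiagonals : ∀ {s} → ℕ → SRTᶠ s → Set
InitialCellsOnDiagonals {s} n R =
  ∀ c → InDiagramᶠ s c → Initial (hookOfᶠ R c) c → Σ ℕ λ i → 1 ≤ i × i ≤ n × OnDiag (diagOfᶠ s i) c

HooksHaveTerminal : ∀ {s} → SRTᶠ s → Set
HooksHaveTerminal {s} R = ∀ c → InDiagramᶠ s c → Σ Cell (Terminal (hookOfᶠ R c))

-- Paths and convexity

cell-subst : ∀ (H : CellSet) {a b a' b'} → H (a , b) → a ≡ a' → b ≡ b' → H (a' , b')
cell-subst H h refl refl = h

Convex : CellSet → Set
Convex H = ∀ {a b c d e f} → H (a , b) → H (e , f) → a ≤ c → c ≤ e → b ≤ d → d ≤ f → H (c , d)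

skew⇒convex : ∀ {H} → IsSkew H → Convex H
skew⇒convex (mu , nu , (_ , mu-linked) , (_ , nu-linked) , _ , H⇔mu∖nu)
            {a} {b} {c} {d} {e} {f} hab hef a≤c c≤e b≤d d≤f =
  proj₂ (H⇔mu∖nu (c , d)) (in-mu , not-in-nu)
  where
    ab∈mu∖nu = proj₁ (H⇔mu∖nu (a , b)) hab
    1≤a = proj₁ (proj₁ ab∈mu∖nu)
    1≤b = proj₁ (proj₂ (proj₁ ab∈mu∖nu))
    f≤mu‼e = proj₂ (proj₂ (proj₁ (proj₁ (H⇔mu∖nu (e , f)) hef)))
    1≤c = ≤-trans 1≤a a≤c
    in-mu : InDiagram mu (c , d)
    in-mu = 1≤c , ≤-trans 1≤b b≤d , ≤-trans d≤f (≤-trans f≤mu‼e (‼-antitone mu-linked 1≤c c≤e))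
    not-in-nu : ¬ InDiagram nu (c , d)
    not-in-nu (_ , _ , d≤nu‼c) =
      proj₂ ab∈mu∖nu (1≤a , 1≤b , ≤-trans b≤d (≤-trans d≤nu‼c (‼-antitone nu-linked 1≤a a≤c)))

Path-start : ∀ {H c d} → Path H c d → H c
Path-start (here h) = h
Path-start (step h _ _) = h

Path-descends : ∀ {H c d k} → Path H c d → row c ≤ k → k < row d →
                Σ ℕ λ y → H (k , y) × H (suc k , y)
Path-descends (here h) c≤k k<c = ⊥-elim (<⇒≱ k<c c≤k)
Path-descends {H} {k = k} (step {c} {d} hc c~d p) c≤k k<end with row d ≤? k
... | yes d≤k = Path-descends p d≤k k<end
... | no d≰k with c~d
...   | inj₁ (same-row , _) = ⊥-elim (d≰k (subst (_≤ k) same-row c≤k))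
...   | inj₂ (_ , inj₂ d+1≡c) = ⊥-elim (d≰k (<⇒≤ (subst (_≤ k) (sym d+1≡c) c≤k)))
...   | inj₂ (same-col , inj₁ c+1≡d) =
  col c , cell-subst H hc c≡k refl ,
  cell-subst H (Path-start p) (trans (sym c+1≡d) (cong suc c≡k)) (sym same-col)
  where
    c≡k : row c ≡ k
    c≡k = ≤-antisym c≤k (≤-pred (≤-trans (≰⇒> d≰k) (≤-reflexive (sym c+1≡d))))

Adjacent-sym : ∀ {c d} → Adjacent c d → Adjacent d c
Adjacent-sym (inj₁ (e , inj₁ x)) = inj₁ (sym e , inj₂ x)
Adjacent-sym (inj₁ (e , inj₂ x)) = inj₁ (sym e , inj₁ x)
Adjacent-sym (inj₂ (e , inj₁ x)) = inj₂ (sym e , inj₂ x)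
Adjacent-sym (inj₂ (e , inj₂ x)) = inj₂ (sym e , inj₁ x)

Path-snoc : ∀ {H c d e} → Path H c d → Adjacent d e → H e → Path H c e
Path-snoc (here h) d~e he = step h d~e (here he)
Path-snoc (step h a p) d~e he = step h a (Path-snoc p d~e he)

Path-reverse : ∀ {H c d} → Path H c d → Path H d c
Path-reverse (here h) = here h
Path-reverse (step h a p) = Path-snoc (Path-reverse p) (Adjacent-sym a) h

Path-++ : ∀ {H c d e} → Path H c d → Path H d e → Path H c e
Path-++ (here h) q = q
Path-++ (step h a p) q = step h a (Path-++ p q)

Path-map : ∀ {H H' : CellSet} → H ⊆ H' → ∀ {c d} → Path H c d → Path H' c d
Path-map f (here h) = here (f h)
Path-map f (step h a p) = step (f h) a (Path-map f p)

IsRimHook-resp-≐ : ∀ {H H'} → H ≐ H' → IsRimHook H → IsRimHook H'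
IsRimHook-resp-≐ (H⊆H' , H'⊆H) ((mu , nu , mu-part , nu-part , nu⊆mu , H⇔) , ((c , hc) , paths) , no2x2) =
  (mu , nu , mu-part , nu-part , nu⊆mu , λ d → (λ h' → proj₁ (H⇔ d) (H'⊆H h')) , (λ x → H⊆H' (proj₂ (H⇔ d) x))) ,
  ((c , H⊆H' hc) , λ c d hc hd → Path-map H⊆H' (paths c d (H'⊆H hc) (H'⊆H hd))) ,
  λ i j (a , b , c , d) → no2x2 i j (H'⊆H a , H'⊆H b , H'⊆H c , H'⊆H d)

-- Two disjoint connected convex sets cannot cross.
module NonCrossing (H B : CellSet) (H-convex : Convex H) (B-convex : Convex B)
  (H-paths : ∀ c d → H c → H d → Path H c d) (B-paths : ∀ c d → B c → B d → Path B c d)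
  (disjoint : ∀ {c} → H c → B c → ⊥) (H-col≥1 : ∀ {c} → H c → 1 ≤ col c) where

  private
    nothing-below′ : ∀ d {k y z r} → r ≡ suc (d + k) → H (k , y) → B (k , z) → y < z → B (r , 1) →
                     ∀ {e} → H e → r ≤ row e → ⊥
    nothing-below′ d {k} {y} {z} {r} r≡ hky bkz y<z br1 {e} he r≤e = descend d r≡
      where
        k<r : k < r
        k<r = subst (k <_) (sym r≡) (s≤s (m≤n+m k d))
        H-step = Path-descends {k = k} (H-paths _ _ hky he) ≤-refl (≤-trans k<r r≤e)
        B-step = Path-descends {k = k} (B-paths _ _ bkz br1) ≤-refl k<r
        y' = proj₁ H-step
        z' = proj₁ B-step
        y'<z' : y' < z'
        y'<z' with y' <? z'
        ... | yes y'<z' = y'<z'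
        ... | no y'≮z' with z ≤? y'
        ...   | yes z≤y' =
          ⊥-elim (disjoint (H-convex hky (proj₁ (proj₂ H-step)) ≤-refl ≤-refl (<⇒≤ y<z) z≤y') bkz)
        ...   | no z≰y' =
          ⊥-elim (disjoint (proj₁ (proj₂ H-step))
                           (B-convex (proj₁ (proj₂ B-step)) bkz ≤-refl ≤-refl (≮⇒≥ y'≮z') (<⇒≤ (≰⇒> z≰y'))))
        descend : ∀ d → r ≡ suc (d + k) → ⊥
        descend zero refl =
          disjoint (proj₂ (proj₂ H-step))
                   (B-convex br1 (proj₂ (proj₂ B-step)) ≤-refl ≤-refl (H-col≥1 (proj₂ (proj₂ H-step))) (<⇒≤ y'<z'))
        descend (suc d') r≡' =
          nothing-below′ d' (trans r≡' (cong suc (sym (+-suc d' k))))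
            (proj₂ (proj₂ H-step)) (proj₂ (proj₂ B-step)) y'<z' br1 he r≤e

  nothing-below : ∀ {k y z r} → k < r → H (k , y) → B (k , z) → y < z → B (r , 1) →
                  ∀ {e} → H e → r ≤ row e → ⊥
  nothing-below {k} {r = r} k<r =
    nothing-below′ (r ∸ suc k) (sym (trans (sym (+-suc (r ∸ suc k) k)) (m∸n+n≡m k<r)))

-- The bottom hook

least-satisfying : {P : ℕ → Set} → (∀ i → Dec (P i)) → ∀ m → P m →
                   Σ ℕ λ t → t ≤ m × P t × (∀ {i} → i < t → ¬ P i)
least-satisfying {P} P? m pm with search m
  where
    search : ∀ m → (Σ ℕ λ t → t ≤ m × P t × (∀ {i} → i < t → ¬ P i)) ⊎ (∀ {i} → i ≤ m → ¬ P i)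
    search zero with P? zero
    ... | yes p0 = inj₁ (zero , z≤n , p0 , λ ())
    ... | no ¬p0 = inj₂ λ { z≤n → ¬p0 }
    search (suc m) with search m
    ... | inj₁ (t , t≤m , pt , below) = inj₁ (t , m≤n⇒m≤1+n t≤m , pt , below)
    ... | inj₂ none≤m with P? (suc m)
    ...   | yes p = inj₁ (suc m , ≤-refl , p , λ i<1+m → none≤m (≤-pred i<1+m))
    ...   | no ¬p = inj₂ none≤1+m
      where
        none≤1+m : ∀ {i} → i ≤ suc m → ¬ P i
        none≤1+m i≤1+m with m≤n⇒m<n∨m≡n i≤1+m
        ... | inj₁ i<1+m = none≤m (≤-pred i<1+m)
        ... | inj₂ refl = ¬p
... | inj₁ least = least
... | inj₂ none = ⊥-elim (none ≤-refl pm)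

BottomHook : (ℕ → ℕ) → ℕ → CellSet
BottomHook s t (i , j) = InDiagramᶠ s (i , j) × t ≤ i × s (suc i) ≤ j

BottomHook? : ∀ s t c → Dec (BottomHook s t c)
BottomHook? s t (i , j) = InDiagramᶠ? s (i , j) ×-dec ((t ≤? i) ×-dec (s (suc i) ≤? j))

empty-top⇒no-bottomHook : ∀ {s n t} → Shape s n → 1 ≤ t → s t ≡ 0 → ∀ {c} → ¬ BottomHook s t c
empty-top⇒no-bottomHook {s} sh 1≤t st≡0 {i , j} ((_ , 1≤j , j≤si) , t≤i , _) =
  <⇒≱ 1≤j (≤-trans j≤si (subst (s i ≤_) st≡0 (antitone sh 1≤t t≤i)))

module HookFacts {s : ℕ → ℕ} (R : SRTᶠ s) {x : Cell} (x∈ : InDiagramᶠ s x) where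
  hook : CellSet
  hook = hookOfᶠ R x

  convex : Convex hook
  convex = skew⇒convex (proj₁ (proj₁ (hooksᶠ R x x∈)))

  paths : ∀ c d → hook c → hook d → Path hook c d
  paths = proj₂ (proj₁ (proj₂ (proj₁ (hooksᶠ R x x∈))))

  no2x2 : No2x2 hook
  no2x2 = proj₂ (proj₂ (proj₁ (hooksᶠ R x x∈)))

  start-row : ℕ
  start-row = proj₁ (proj₂ (hooksᶠ R x x∈))

  start : hook (start-row , 1)
  start = proj₂ (proj₂ (hooksᶠ R x x∈))

-- The hook through (n , 1) is the bottom hook whose top row is the first row ending in it.
module BottomHookStructure {s : ℕ → ℕ} {n' : ℕ} (sh : Shape s (suc n')) (R : SRTᶠ s) (1≤sn : 1 ≤ s (suc n')) where
  n : ℕ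
  n = suc n'

  L : Cell → ℕ
  L = labelᶠ R

  corner : Cell
  corner = (n , 1)

  corner∈ : InDiagramᶠ s corner
  corner∈ = s≤s z≤n , s≤s z≤n , 1≤sn

  open HookFacts R corner∈

  corner∈hook : hook corner
  corner∈hook = corner∈ , refl

  hook-col≥1 : ∀ {c} → hook c → 1 ≤ col c
  hook-col≥1 h = proj₁ (proj₂ (proj₁ h))

  right-of-hook : ∀ {k y z} → hook (k , y) → InDiagramᶠ s (k , z) → y < z → hook (k , z)
  right-of-hook {k} {y} {z} hky kz∈ y<z with L (k , z) ≟ L corner
  ... | yes same = kz∈ , same
  ... | no other with Other.start-row ≤? k
    where module Other = HookFacts R kz∈
  ...   | yes r≤k =
    ⊥-elim (disjoint hky (Other.convex Other.start kz r≤k ≤-refl (hook-col≥1 hky) (<⇒≤ y<z)))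
    where
      module Other = HookFacts R kz∈
      kz : Other.hook (k , z)
      kz = kz∈ , refl
      disjoint : ∀ {c} → hook c → Other.hook c → ⊥
      disjoint (_ , c∈hook) (_ , c∈other) = other (trans (sym c∈other) c∈hook)
  ...   | no r≰k =
    ⊥-elim (NonCrossing.nothing-below hook Other.hook convex Other.convex paths Other.paths disjoint hook-col≥1
              (≰⇒> r≰k) hky (kz∈ , refl) y<z Other.start corner∈hook (row≤bound sh (proj₁ Other.start)))
    where
      module Other = HookFacts R kz∈
      disjoint : ∀ {c} → hook c → Other.hook c → ⊥
      disjoint (_ , c∈hook) (_ , c∈other) = other (trans (sym c∈other) c∈hook)

  hook-to-row-end : ∀ {i y z} → hook (i , y) → y ≤ z → z ≤ s i → hook (i , z)
  hook-to-row-end {i} {y} {z} hiy y≤z z≤si with m≤n⇒m<n∨m≡n y≤z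
  ... | inj₂ refl = hiy
  ... | inj₁ y<z = right-of-hook hiy (proj₁ (proj₁ hiy) , ≤-trans (hook-col≥1 hiy) y≤z , z≤si) y<z

  hook⊆rim : ∀ {i j} → hook (i , j) → s (suc i) ≤ j
  hook⊆rim {i} {j} hij with s (suc i) ≤? j
  ... | yes below-empty = below-empty
  ... | no below-full = ⊥-elim (no2x2 i j (hij , hook-convex-below , right , below-right))
    where
      below-right∈ : InDiagramᶠ s (suc i , suc j)
      below-right∈ = s≤s z≤n , s≤s z≤n , ≰⇒> below-full
      i<n : i < n
      i<n = row≤bound sh below-right∈
      crossing = Path-descends {k = i} (paths _ _ hij corner∈hook) ≤-refl i<n
      y = proj₁ crossing
      below-right : hook (suc i , suc j)
      below-right with suc j ≤? y
      ... | yes 1+j≤y = convex hij (proj₂ (proj₂ crossing)) (n≤1+n i) ≤-refl (n≤1+n j) 1+j≤y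
      ... | no 1+j≰y = right-of-hook (proj₂ (proj₂ crossing)) below-right∈ (≰⇒> 1+j≰y)
      hook-convex-below : hook (suc i , j)
      hook-convex-below = convex hij below-right (n≤1+n i) ≤-refl ≤-refl (n≤1+n j)
      right : hook (i , suc j)
      right = convex hij below-right ≤-refl (n≤1+n i) (n≤1+n j) ≤-refl

  hook-descends : ∀ {i y} → hook (i , y) → i < n → hook (i , s (suc i)) × hook (suc i , s (suc i))
  hook-descends {i} {y} h i<n =
    cell-subst hook (proj₁ (proj₂ crossing)) refl y≡ , cell-subst hook (proj₂ (proj₂ crossing)) refl y≡
    where
      crossing = Path-descends {k = i} (paths _ _ h corner∈hook) ≤-refl i<n
      y≡ : proj₁ crossing ≡ s (suc i)
      y≡ = ≤-antisym (proj₂ (proj₂ (proj₁ (proj₂ (proj₂ crossing))))) (hook⊆rim (proj₁ (proj₂ crossing)))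

  EndsInHook : ℕ → Set
  EndsInHook i = hook (i , s i)

  top-search : Σ ℕ λ t → t ≤ n × EndsInHook t × (∀ {i} → i < t → ¬ EndsInHook i)
  top-search = least-satisfying (λ i → InDiagramᶠ? s (i , s i) ×-dec (L (i , s i) ≟ L corner)) n
                                 (hook-to-row-end corner∈hook 1≤sn ≤-refl)

  top : ℕ
  top = proj₁ top-search

  top≤n : top ≤ n
  top≤n = proj₁ (proj₂ top-search)

  top-ends-in-hook : EndsInHook top
  top-ends-in-hook = proj₁ (proj₂ (proj₂ top-search))

  1≤top : 1 ≤ top
  1≤top = proj₁ (proj₁ top-ends-in-hook)

  hook⊆bottomHook : hook ⊆ BottomHook s top
  hook⊆bottomHook {i , j} h = proj₁ h , top≤i , hook⊆rim h
    where
      top≤i : top ≤ i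
      top≤i with top ≤? i
      ... | yes top≤i = top≤i
      ... | no top≰i = ⊥-elim (proj₂ (proj₂ (proj₂ top-search)) (≰⇒> top≰i)
                                  (hook-to-row-end h (proj₂ (proj₂ (proj₁ h))) ≤-refl))

  ends-in-hook-below-top : ∀ k → top + k ≤ n → EndsInHook (top + k)
  ends-in-hook-below-top zero _ = subst EndsInHook (sym (+-identityʳ top)) top-ends-in-hook
  ends-in-hook-below-top (suc k) top+1+k≤n =
    subst EndsInHook (sym (+-suc top k))
      (proj₂ (hook-descends (ends-in-hook-below-top k (≤-trans (n≤1+n _) top+k<n)) top+k<n))
    where
      top+k<n : top + k < n
      top+k<n = ≤-trans (≤-reflexive (sym (+-suc top k))) top+1+k≤n

  bottomHook⊆hook : BottomHook s top ⊆ hook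
  bottomHook⊆hook {i , j} (ij∈@(_ , 1≤j , j≤si) , top≤i , si+1≤j) with i <? n
  ... | yes i<n = convex (proj₁ (hook-descends ends-in-i i<n)) ends-in-i ≤-refl ≤-refl si+1≤j j≤si
    where
      ends-in-i : EndsInHook i
      ends-in-i = subst EndsInHook (m+[n∸m]≡n top≤i)
                    (ends-in-hook-below-top (i ∸ top) (≤-trans (≤-reflexive (m+[n∸m]≡n top≤i)) (row≤bound sh ij∈)))
  ... | no i≮n = cell-subst hook (hook-to-row-end corner∈hook 1≤j (subst (λ r → j ≤ s r) i≡n j≤si)) (sym i≡n) refl
    where
      i≡n : i ≡ n
      i≡n = ≤-antisym (row≤bound sh ij∈) (≮⇒≥ i≮n)

  hook≐bottomHook : hook ≐ BottomHook s top
  hook≐bottomHook = hook⊆bottomHook , bottomHook⊆hook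

IsHookOf : ∀ {s} → SRTᶠ s → CellSet → Set
IsHookOf R H = ∀ {c} → H c → hookOfᶠ R c ≐ H

hook≐⇒IsHookOf : ∀ {s} (R : SRTᶠ s) {x H} → hookOfᶠ R x ≐ H → IsHookOf R H
hook≐⇒IsHookOf R {x} (⊆H , H⊆) hc =
  (λ (d∈ , Ld≡Lc) → ⊆H (d∈ , trans Ld≡Lc Lc≡Lx)) ,
  (λ hd → proj₁ (H⊆ hd) , trans (proj₂ (H⊆ hd)) (sym Lc≡Lx))
  where
    Lc≡Lx = proj₂ (H⊆ hc)

IsHookOf⇒disjoint : ∀ {s} {R : SRTᶠ s} {H} → IsHookOf R H →
                    ∀ {c} → InDiagramᶠ s c → ¬ H c → ∀ {d} → hookOfᶠ R c d → ¬ H d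
IsHookOf⇒disjoint H-hook c∈ ¬hc (_ , Ld≡Lc) hd = ¬hc (proj₁ (H-hook hd) (c∈ , sym Ld≡Lc))

bottomHook-isHook : ∀ {s n'} → Shape s (suc n') → 1 ≤ s (suc n') → (R : SRTᶠ s) →
                    Σ ℕ λ t → 1 ≤ t × t ≤ suc n' × IsHookOf R (BottomHook s t)
bottomHook-isHook sh 1≤sn R = top , 1≤top , top≤n , hook≐⇒IsHookOf R hook≐bottomHook
  where open BottomHookStructure sh R 1≤sn

removeBottomHook : (ℕ → ℕ) → ℕ → ℕ → ℕ
removeBottomHook s t i with i <? t
... | yes _ = s i
... | no _ = pred (s (suc i))

module _ {s : ℕ → ℕ} {t : ℕ} where
  removeBottomHook-above : ∀ {i} → i < t → removeBottomHook s t i ≡ s i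
  removeBottomHook-above {i} i<t with i <? t
  ... | yes _ = refl
  ... | no i≮t = ⊥-elim (i≮t i<t)

  removeBottomHook-below : ∀ {i} → t ≤ i → removeBottomHook s t i ≡ pred (s (suc i))
  removeBottomHook-below {i} t≤i with i <? t
  ... | yes i<t = ⊥-elim (<⇒≱ i<t t≤i)
  ... | no _ = refl

removeBottomHook-shape : ∀ {s n' t} → Shape s (suc n') → 1 ≤ t → t ≤ suc n' → Shape (removeBottomHook s t) n'
antitone (removeBottomHook-shape {s} {n'} {t} sh 1≤t t≤n) {i} {j} 1≤i i≤j
  with <-≤-connex j t | <-≤-connex i t
... | inj₁ j<t | inj₁ i<t =
  subst₂ _≤_ (sym (removeBottomHook-above j<t)) (sym (removeBottomHook-above i<t)) (antitone sh 1≤i i≤j)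
... | inj₁ j<t | inj₂ t≤i = ⊥-elim (<⇒≱ (≤-<-trans i≤j j<t) t≤i)
... | inj₂ t≤j | inj₁ i<t =
  subst₂ _≤_ (sym (removeBottomHook-below t≤j)) (sym (removeBottomHook-above i<t))
    (≤-trans pred[n]≤n (antitone sh 1≤i (m≤n⇒m≤1+n i≤j)))
... | inj₂ t≤j | inj₂ t≤i =
  subst₂ _≤_ (sym (removeBottomHook-below t≤j)) (sym (removeBottomHook-below t≤i))
    (pred-mono-≤ (antitone sh (s≤s z≤n) (s≤s i≤j)))
vanishes (removeBottomHook-shape {s} {n'} {t} sh 1≤t t≤n) n'<i =
  trans (removeBottomHook-below (≤-trans t≤n n'<i)) (cong pred (vanishes sh (s≤s n'<i)))

module RemovedDiagram {s : ℕ → ℕ} {n : ℕ} (sh : Shape s n) (t : ℕ) where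
  μ : ℕ → ℕ
  μ = removeBottomHook s t

  removed⊆diagram : ∀ {c} → InDiagramᶠ μ c → InDiagramᶠ s c
  removed⊆diagram {i , j} (1≤i , 1≤j , j≤μi) with <-≤-connex i t
  ... | inj₁ i<t = 1≤i , 1≤j , subst (j ≤_) (removeBottomHook-above i<t) j≤μi
  ... | inj₂ t≤i = 1≤i , 1≤j , ≤-trans (≤-trans (subst (j ≤_) (removeBottomHook-below t≤i) j≤μi) pred[n]≤n)
                                       (antitone sh 1≤i (n≤1+n i))

  removed-avoids-bottomHook : ∀ {c} → InDiagramᶠ μ c → ¬ BottomHook s t c
  removed-avoids-bottomHook {i , j} (1≤i , 1≤j , j≤μi) (_ , t≤i , si+1≤j) =
    <⇒≱ (j<si+1 (subst (j ≤_) (removeBottomHook-below t≤i) j≤μi)) si+1≤j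
    where
      j<si+1 : j ≤ pred (s (suc i)) → j < s (suc i)
      j<si+1 j≤ with s (suc i)
      ... | zero = ⊥-elim (<⇒≱ 1≤j j≤)
      ... | suc _ = s≤s j≤

  diagram∖bottomHook⊆removed : ∀ {c} → InDiagramᶠ s c → ¬ BottomHook s t c → InDiagramᶠ μ c
  diagram∖bottomHook⊆removed {i , j} c∈@(1≤i , 1≤j , j≤si) ¬bottom with <-≤-connex i t
  ... | inj₁ i<t = 1≤i , 1≤j , subst (j ≤_) (sym (removeBottomHook-above i<t)) j≤si
  ... | inj₂ t≤i = 1≤i , 1≤j , subst (j ≤_) (sym (removeBottomHook-below t≤i)) (<⇒≤pred j<si+1)
    where
      j<si+1 : j < s (suc i)
      j<si+1 with s (suc i) ≤? j
      ... | yes si+1≤j = ⊥-elim (¬bottom (c∈ , t≤i , si+1≤j))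
      ... | no si+1≰j = ≰⇒> si+1≰j

module BottomHookIsRimHook {s : ℕ → ℕ} {n' : ℕ} (sh : Shape s (suc n')) (1≤sn : 1 ≤ s (suc n'))
                           {t : ℕ} (1≤t : 1 ≤ t) (t≤n : t ≤ suc n') where
  n : ℕ
  n = suc n'

  H : CellSet
  H = BottomHook s t
  open RemovedDiagram sh t

  corner∈H : H (n , 1)
  corner∈H = (s≤s z≤n , s≤s z≤n , 1≤sn) , t≤n , subst (_≤ 1) (sym (vanishes sh ≤-refl)) z≤n

  skew : IsSkew H
  skew = rowsToList s n , rowsToList μ n , rowsToList-partition sh , rowsToList-partition μ-shape ,
         (λ _ c∈ν → ⊆λ (removed⊆diagram (⊆μ c∈ν))) , λ c → H⇒λ∖ν , λ∖ν⇒H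
    where
      μ-shape : Shape μ n
      μ-shape = Shape-weaken (removeBottomHook-shape sh 1≤t t≤n)
      ⊆λ = proj₂ (rowsToList-diagram sh)
      ⊆μ = proj₁ (rowsToList-diagram μ-shape)
      H⇒λ∖ν : ∀ {c} → H c → InDiagram (rowsToList s n) c × ¬ InDiagram (rowsToList μ n) c
      H⇒λ∖ν hc = ⊆λ (proj₁ hc) , λ c∈ν → removed-avoids-bottomHook (⊆μ c∈ν) hc
      λ∖ν⇒H : ∀ {c} → InDiagram (rowsToList s n) c × ¬ InDiagram (rowsToList μ n) c → H c
      λ∖ν⇒H {c} (c∈λ , c∉ν) with BottomHook? s t c
      ... | yes hc = hc
      ... | no ¬hc = ⊥-elim (c∉ν (proj₂ (rowsToList-diagram μ-shape)
                                      (diagram∖bottomHook⊆removed (proj₁ (rowsToList-diagram sh) c∈λ) ¬hc)))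

  no2x2 : No2x2 H
  no2x2 i j (hij , _ , _ , hi+1j+1) = <⇒≱ (proj₂ (proj₂ (proj₁ hi+1j+1))) (proj₂ (proj₂ hij))

  along-row : ∀ {i j} j' → H (i , j) → H (i , j') → j ≤ j' → Path H (i , j') (i , j)
  along-row j' hj hj' j≤j' with m≤n⇒m<n∨m≡n j≤j'
  ... | inj₂ refl = here hj
  along-row (suc j') hj@((1≤i , 1≤j , _) , t≤i , below≤j) hj'@((_ , _ , j'+1≤si) , _) _ | inj₁ (s≤s j≤j') =
    step hj' (inj₁ (refl , inj₂ refl))
      (along-row j' hj ((1≤i , ≤-trans 1≤j j≤j' , <⇒≤ j'+1≤si) , t≤i , ≤-trans below≤j j≤j') j≤j')

  to-corner : ∀ d {i j} → d + i ≡ n → H (i , j) → Path H (i , j) (n , 1)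
  to-corner zero refl hij = along-row _ corner∈H hij (proj₁ (proj₂ (proj₁ hij)))
  to-corner (suc d) {i} {j} d+1+i≡n hij@((1≤i , _ , _) , t≤i , si+1≤j) =
    Path-++ (along-row j row-end hij si+1≤j)
            (step row-end (inj₂ (refl , inj₁ refl)) (to-corner d (trans (+-suc d i) d+1+i≡n) next-row-end))
    where
      1≤si+1 : 1 ≤ s (suc i)
      1≤si+1 = ≤-trans 1≤sn (antitone sh (s≤s z≤n) (subst (suc i ≤_) d+1+i≡n (s≤s (m≤n+m i d))))
      row-end : H (i , s (suc i))
      row-end = (1≤i , 1≤si+1 , antitone sh 1≤i (n≤1+n i)) , t≤i , ≤-refl
      next-row-end : H (suc i , s (suc i))
      next-row-end = (s≤s z≤n , 1≤si+1 , ≤-refl) , m≤n⇒m≤1+n t≤i , antitone sh (s≤s z≤n) (n≤1+n (suc i))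

  path-to-corner : ∀ c → H c → Path H c (n , 1)
  path-to-corner (i , j) hc = to-corner (n ∸ i) (m∸n+n≡m (row≤bound sh (proj₁ hc))) hc

  rimHook : IsRimHook H
  rimHook = skew ,
            (((n , 1) , corner∈H) , λ c d hc hd → Path-++ (path-to-corner c hc) (Path-reverse (path-to-corner d hd))) ,
            no2x2

-- Counting cells

count : {P : CellSet} → U.Decidable P → List Cell → ℕ
count P? xs = length (filter P? xs)

rowCells : ℕ → ℕ → List Cell
rowCells i k = map (λ j → (i , suc j)) (upTo k)

rowCells-suc : ∀ i k → rowCells i (suc k) ≡ rowCells i k ++ [ (i , suc k) ]
rowCells-suc i k = trans (cong (map (λ j → (i , suc j))) (sym (upTo-∷ʳ k))) (map-++ _ (upTo k) [ k ])

cellsᶠ-suc : ∀ s m → cellsᶠ s (suc m) ≡ cellsᶠ s m ++ rowCells (suc m) (s (suc m))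
cellsᶠ-suc s m = begin
    concatMap rowOf (map suc (upTo (suc m)))
  ≡⟨ cong (concatMap rowOf) (trans (cong (map suc) (sym (upTo-∷ʳ m))) (map-++ suc (upTo m) [ m ])) ⟩
    concatMap rowOf (map suc (upTo m) ++ [ suc m ])
  ≡⟨ concatMap-++ rowOf (map suc (upTo m)) [ suc m ] ⟩
    cellsᶠ s m ++ (rowCells (suc m) (s (suc m)) ++ [])
  ≡⟨ cong (cellsᶠ s m ++_) (++-identityʳ _) ⟩
    cellsᶠ s m ++ rowCells (suc m) (s (suc m)) ∎
  where
    open ≡-Reasoning
    rowOf = λ i → rowCells i (s i)

module Counting {P : CellSet} (P? : U.Decidable P) where
  count-++ : ∀ xs ys → count P? (xs ++ ys) ≡ count P? xs + count P? ys
  count-++ xs ys = trans (cong length (filter-++ P? xs ys)) (length-++ (filter P? xs))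

  count-[x]-∈ : ∀ {x} → P x → count P? [ x ] ≡ 1
  count-[x]-∈ {x} px with P? x
  ... | yes _ = refl
  ... | no ¬px = ⊥-elim (¬px px)

  count-[x]-∉ : ∀ {x} → ¬ P x → count P? [ x ] ≡ 0
  count-[x]-∉ {x} ¬px with P? x
  ... | yes px = ⊥-elim (¬px px)
  ... | no _ = refl

  count-rowCells-suc : ∀ i k → count P? (rowCells i (suc k)) ≡ count P? (rowCells i k) + count P? [ (i , suc k) ]
  count-rowCells-suc i k = trans (cong (count P?) (rowCells-suc i k)) (count-++ (rowCells i k) _)

  count-cellsᶠ-suc : ∀ s m → count P? (cellsᶠ s (suc m)) ≡ count P? (cellsᶠ s m) + count P? (rowCells (suc m) (s (suc m)))
  count-cellsᶠ-suc s m = trans (cong (count P?) (cellsᶠ-suc s m)) (count-++ (cellsᶠ s m) _)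

  count-row-prefix : ∀ i {b} k → b ≤ k → (∀ {j} → b ≤ j → j < k → ¬ P (i , suc j)) →
                     count P? (rowCells i k) ≡ count P? (rowCells i b)
  count-row-prefix i zero z≤n _ = refl
  count-row-prefix i {b} (suc k) b≤1+k none with m≤n⇒m<n∨m≡n b≤1+k
  ... | inj₂ refl = refl
  ... | inj₁ (s≤s b≤k) = begin
      count P? (rowCells i (suc k))
    ≡⟨ count-rowCells-suc i k ⟩
      count P? (rowCells i k) + count P? [ (i , suc k) ]
    ≡⟨ cong₂ _+_ (count-row-prefix i k b≤k λ b≤j j<k → none b≤j (m≤n⇒m≤1+n j<k))
                 (count-[x]-∉ (none b≤k ≤-refl)) ⟩
      count P? (rowCells i b) + 0
    ≡⟨ +-identityʳ _ ⟩
      count P? (rowCells i b) ∎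
    where open ≡-Reasoning

  count-row-suffix : ∀ i k {a} → 1 ≤ a → a ≤ suc k →
                     (∀ {j} → j < k → (P (i , suc j) → a ≤ suc j) × (a ≤ suc j → P (i , suc j))) →
                     count P? (rowCells i k) + a ≡ suc k
  count-row-suffix i zero 1≤a a≤1 _ = ≤-antisym a≤1 1≤a
  count-row-suffix i (suc k) {a} 1≤a a≤2+k P⇔a≤ with m≤n⇒m<n∨m≡n a≤2+k
  ... | inj₁ (s≤s a≤1+k) = begin
      count P? (rowCells i (suc k)) + a
    ≡⟨ cong (_+ a) (count-rowCells-suc i k) ⟩
      count P? (rowCells i k) + count P? [ (i , suc k) ] + a
    ≡⟨ cong (λ x → count P? (rowCells i k) + x + a) (count-[x]-∈ (proj₂ (P⇔a≤ ≤-refl) a≤1+k)) ⟩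
      count P? (rowCells i k) + 1 + a
    ≡⟨ cong (_+ a) (+-comm _ 1) ⟩
      suc (count P? (rowCells i k) + a)
    ≡⟨ cong suc (count-row-suffix i k 1≤a a≤1+k λ j<k → P⇔a≤ (m≤n⇒m≤1+n j<k)) ⟩
      suc (suc k) ∎
    where open ≡-Reasoning
  ... | inj₂ refl = begin
      count P? (rowCells i (suc k)) + suc (suc k)
    ≡⟨ cong (_+ suc (suc k))
            (count-row-prefix i (suc k) z≤n λ _ j<1+k pj → <⇒≱ (s≤s j<1+k) (proj₁ (P⇔a≤ j<1+k) pj)) ⟩
      suc (suc k) ∎
    where open ≡-Reasoning

  count-cells-drop-row : ∀ s m → (∀ {j} → j < s (suc m) → ¬ P (suc m , suc j)) →
                         count P? (cellsᶠ s (suc m)) ≡ count P? (cellsᶠ s m)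
  count-cells-drop-row s m none =
    trans (count-cellsᶠ-suc s m)
          (trans (cong (_+_ (count P? (cellsᶠ s m))) (count-row-prefix (suc m) (s (suc m)) z≤n λ _ → none))
                 (+-identityʳ _))

  count-cells-shrink : ∀ s μ m → (∀ {i} → 1 ≤ i → i ≤ m → μ i ≤ s i) →
                       (∀ {i j} → 1 ≤ i → i ≤ m → μ i ≤ j → j < s i → ¬ P (i , suc j)) →
                       count P? (cellsᶠ s m) ≡ count P? (cellsᶠ μ m)
  count-cells-shrink s μ zero _ _ = refl
  count-cells-shrink s μ (suc m) μ≤s none = begin
      count P? (cellsᶠ s (suc m))
    ≡⟨ count-cellsᶠ-suc s m ⟩
      count P? (cellsᶠ s m) + count P? (rowCells (suc m) (s (suc m)))
    ≡⟨ cong₂ _+_ (count-cells-shrink s μ m (λ 1≤i i≤m → μ≤s 1≤i (m≤n⇒m≤1+n i≤m))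
                                            (λ 1≤i i≤m → none 1≤i (m≤n⇒m≤1+n i≤m)))
                 (count-row-prefix (suc m) (s (suc m)) (μ≤s (s≤s z≤n) ≤-refl) (none (s≤s z≤n) ≤-refl)) ⟩
      count P? (cellsᶠ μ m) + count P? (rowCells (suc m) (μ (suc m)))
    ≡⟨ sym (count-cellsᶠ-suc μ m) ⟩
      count P? (cellsᶠ μ (suc m)) ∎
    where open ≡-Reasoning

count-row-cong : ∀ {P Q : CellSet} (P? : U.Decidable P) (Q? : U.Decidable Q) i k →
                 (∀ {j} → j < k → (P (i , suc j) → Q (i , suc j)) × (Q (i , suc j) → P (i , suc j))) →
                 count P? (rowCells i k) ≡ count Q? (rowCells i k)
count-row-cong P? Q? i zero _ = refl
count-row-cong {P} {Q} P? Q? i (suc k) P⇔Q =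
  trans (Counting.count-rowCells-suc P? i k)
        (trans (cong₂ _+_ (count-row-cong P? Q? i k λ j<k → P⇔Q (m≤n⇒m≤1+n j<k)) last)
               (sym (Counting.count-rowCells-suc Q? i k)))
  where
    last : count P? [ (i , suc k) ] ≡ count Q? [ (i , suc k) ]
    last with P? (i , suc k) | Q? (i , suc k)
    ... | yes _ | yes _ = refl
    ... | no _ | no _ = refl
    ... | yes p | no ¬q = ⊥-elim (¬q (proj₁ (P⇔Q ≤-refl) p))
    ... | no ¬p | yes q = ⊥-elim (¬p (proj₂ (P⇔Q ≤-refl) q))

count-cells-cong : ∀ {P Q : CellSet} (P? : U.Decidable P) (Q? : U.Decidable Q) s m →
                   (∀ {c} → InDiagramᶠ s c → (P c → Q c) × (Q c → P c)) →
                   count P? (cellsᶠ s m) ≡ count Q? (cellsᶠ s m)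
count-cells-cong P? Q? s zero _ = refl
count-cells-cong P? Q? s (suc m) P⇔Q =
  trans (Counting.count-cellsᶠ-suc P? s m)
        (trans (cong₂ _+_ (count-cells-cong P? Q? s m P⇔Q)
                          (count-row-cong P? Q? (suc m) (s (suc m)) λ j<k → P⇔Q (s≤s z≤n , s≤s z≤n , j<k)))
               (sym (Counting.count-cellsᶠ-suc Q? s m)))

module BottomHookSize {s : ℕ → ℕ} {n' : ℕ} (sh : Shape s (suc n')) (1≤sn : 1 ≤ s (suc n'))
                      {t : ℕ} (1≤t : 1 ≤ t) (t≤n : t ≤ suc n') where
  n : ℕ
  n = suc n'
  open Counting (BottomHook? s t)

  cellsUpTo : ℕ → ℕ
  cellsUpTo m = count (BottomHook? s t) (cellsᶠ s m)

  cellsInRow : ℕ → ℕ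
  cellsInRow i = count (BottomHook? s t) (rowCells i (s i))

  1≤s : ∀ {i} → 1 ≤ i → i ≤ n → 1 ≤ s i
  1≤s 1≤i i≤n = ≤-trans 1≤sn (antitone sh 1≤i i≤n)

  above-top : ∀ m → m < t → cellsUpTo m ≡ 0
  above-top zero _ = refl
  above-top (suc m) m+1<t =
    trans (count-cellsᶠ-suc s m)
          (cong₂ _+_ (above-top m (<⇒≤ m+1<t))
                     (count-row-prefix (suc m) (s (suc m)) z≤n λ _ _ h → <⇒≱ m+1<t (proj₁ (proj₂ h))))

  row-middle : ∀ {i} → t ≤ i → i < n → cellsInRow i + s (suc i) ≡ suc (s i)
  row-middle {i} t≤i i<n =
    count-row-suffix i (s i) (1≤s (s≤s z≤n) i<n) (m≤n⇒m≤1+n (antitone sh 1≤i (n≤1+n i)))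
      λ j<si → (λ h → proj₂ (proj₂ h)) , λ si+1≤j → (1≤i , s≤s z≤n , j<si) , t≤i , si+1≤j
    where 1≤i = ≤-trans 1≤t t≤i

  row-last : cellsInRow n + 1 ≡ suc (s n)
  row-last = count-row-suffix n (s n) ≤-refl (s≤s z≤n)
    λ j<sn → (λ _ → s≤s z≤n) ,
             λ _ → (s≤s z≤n , s≤s z≤n , j<sn) , t≤n , subst (_≤ suc _) (sym (vanishes sh ≤-refl)) z≤n

  up-to-row : ∀ m → t ≤ suc m → m < n → cellsUpTo m + s (suc m) + t ≡ s t + suc m
  up-to-row m t≤m+1 m<n with m≤n⇒m<n∨m≡n t≤m+1
  ... | inj₂ refl = cong (λ x → x + s t + t) (above-top m ≤-refl)
  up-to-row zero _ _ | inj₁ (s≤s t≤0) = ⊥-elim (<⇒≱ 1≤t t≤0)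
  up-to-row (suc m) t≤m+2 m+1<n | inj₁ (s≤s t≤m+1) = begin
      cellsUpTo (suc m) + s (suc (suc m)) + t
    ≡⟨ cong (λ x → x + s (suc (suc m)) + t) (count-cellsᶠ-suc s m) ⟩
      cellsUpTo m + cellsInRow (suc m) + s (suc (suc m)) + t
    ≡⟨ cong (_+ t) (+-assoc (cellsUpTo m) _ _) ⟩
      cellsUpTo m + (cellsInRow (suc m) + s (suc (suc m))) + t
    ≡⟨ cong (λ x → cellsUpTo m + x + t) (row-middle t≤m+1 m+1<n) ⟩
      cellsUpTo m + suc (s (suc m)) + t
    ≡⟨ cong (_+ t) (+-suc (cellsUpTo m) _) ⟩
      suc (cellsUpTo m + s (suc m) + t)
    ≡⟨ cong suc (up-to-row m t≤m+1 (<⇒≤ m+1<n)) ⟩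
      suc (s t + suc m)
    ≡⟨ sym (+-suc (s t) (suc m)) ⟩
      s t + suc (suc m) ∎
    where open ≡-Reasoning

  bottomHook-size : cellsUpTo n + t ≡ s t + n
  bottomHook-size = begin
      cellsUpTo n + t
    ≡⟨ cong (_+ t) (count-cellsᶠ-suc s n') ⟩
      cellsUpTo n' + cellsInRow n + t
    ≡⟨ cong (λ x → cellsUpTo n' + x + t) (+-cancelʳ-≡ 1 _ _ (trans row-last (+-comm 1 (s n)))) ⟩
      cellsUpTo n' + s n + t
    ≡⟨ up-to-row n' t≤n ≤-refl ⟩
      s t + n ∎
    where open ≡-Reasoning

-- Permutations in one-line notation

‼-++ˡ : ∀ xs ys {i} → 1 ≤ i → i ≤ length xs → (xs ++ ys) ‼ i ≡ xs ‼ i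
‼-++ˡ (x ∷ xs) ys {suc zero} _ _ = refl
‼-++ˡ (x ∷ xs) ys {suc (suc i)} _ (s≤s i+1≤l) = ‼-++ˡ xs ys (s≤s z≤n) i+1≤l

‼-++ʳ : ∀ xs ys k → (xs ++ ys) ‼ (length xs + suc k) ≡ ys ‼ suc k
‼-++ʳ [] ys k = refl
‼-++ʳ (x ∷ []) ys k = refl
‼-++ʳ (x ∷ y ∷ xs) ys k = ‼-++ʳ (y ∷ xs) ys k

‼-∷ : ∀ (v : ℕ) ys k → (v ∷ ys) ‼ suc (suc k) ≡ ys ‼ suc k
‼-∷ v [] k = refl
‼-∷ v (y ∷ ys) k = refl

‼-∈ : ∀ (σ : List ℕ) {i} → 1 ≤ i → i ≤ length σ → σ ‼ i ∈ σ
‼-∈ (x ∷ σ) {suc zero} _ _ = here refl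
‼-∈ (x ∷ σ) {suc (suc i)} _ (s≤s i+1≤l) = there (‼-∈ σ (s≤s z≤n) i+1≤l)

record Deletion (t v : ℕ) (σ σ' : List ℕ) : Set where
  field
    deleted : σ ‼ t ≡ v
    before : ∀ {i} → 1 ≤ i → i < t → σ' ‼ i ≡ σ ‼ i
    after : ∀ {i} → t ≤ i → σ' ‼ i ≡ σ ‼ suc i

deletion-++ : ∀ v xs ys → Deletion (suc (length xs)) v (xs ++ v ∷ ys) (xs ++ ys)
deletion-++ v xs ys = record
  { deleted = trans (cong ((xs ++ v ∷ ys) ‼_) (sym (+-comm (length xs) 1))) (‼-++ʳ xs (v ∷ ys) 0)
  ; before = λ 1≤i i≤l → trans (‼-++ˡ xs ys 1≤i (≤-pred i≤l)) (sym (‼-++ˡ xs (v ∷ ys) 1≤i (≤-pred i≤l)))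
  ; after = after
  }
  where
    after : ∀ {i} → suc (length xs) ≤ i → (xs ++ ys) ‼ i ≡ (xs ++ v ∷ ys) ‼ suc i
    after {i} l<i = begin
        (xs ++ ys) ‼ i
      ≡⟨ cong ((xs ++ ys) ‼_) (sym i≡) ⟩
        (xs ++ ys) ‼ (length xs + suc k)
      ≡⟨ ‼-++ʳ xs ys k ⟩
        ys ‼ suc k
      ≡⟨ sym (‼-∷ v ys k) ⟩
        (v ∷ ys) ‼ suc (suc k)
      ≡⟨ sym (‼-++ʳ xs (v ∷ ys) (suc k)) ⟩
        (xs ++ v ∷ ys) ‼ (length xs + suc (suc k))
      ≡⟨ cong ((xs ++ v ∷ ys) ‼_) (trans (+-suc (length xs) (suc k)) (cong suc i≡)) ⟩
        (xs ++ v ∷ ys) ‼ suc i ∎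
      where
        open ≡-Reasoning
        k = i ∸ suc (length xs)
        i≡ : length xs + suc k ≡ i
        i≡ = trans (+-suc (length xs) k) (m+[n∸m]≡n l<i)

‼-split : ∀ (σ : List ℕ) k {v} → σ ‼ suc k ≡ v → 1 ≤ v →
          Σ (List ℕ) λ xs → Σ (List ℕ) λ ys → σ ≡ xs ++ v ∷ ys × length xs ≡ k
‼-split [] k refl ()
‼-split (x ∷ σ) zero refl _ = [] , σ , refl , refl
‼-split (x ∷ σ) (suc k) σk≡v 1≤v with ‼-split σ k (trans (sym (‼-∷ x σ k)) σk≡v) 1≤v
... | xs , ys , σ≡ , l≡k = x ∷ xs , ys , cong (x ∷_) σ≡ , cong suc l≡k

deletion-at : ∀ (σ : List ℕ) {t v} → 1 ≤ t → 1 ≤ v → σ ‼ t ≡ v → Σ (List ℕ) (Deletion t v σ)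
deletion-at σ {suc k} {v} _ 1≤v σt≡v with ‼-split σ k σt≡v 1≤v
... | xs , ys , refl , refl = xs ++ ys , deletion-++ v xs ys

insertion : ∀ {t} v (σ' : List ℕ) → 1 ≤ t → t ≤ suc (length σ') →
            Σ (List ℕ) λ xs → Σ (List ℕ) λ ys → σ' ≡ xs ++ ys × Deletion t v (xs ++ v ∷ ys) σ'
insertion {suc k} v σ' _ (s≤s k≤l) =
  take k σ' , drop k σ' , sym (take++drop≡id k σ') ,
  subst (λ t → Deletion t v (xs ++ v ∷ ys) σ') (cong suc length-take-k)
        (subst (Deletion _ v (xs ++ v ∷ ys)) (take++drop≡id k σ') (deletion-++ v xs ys))
  where
    xs = take k σ'
    ys = drop k σ'
    length-take-k : length xs ≡ k
    length-take-k = trans (length-take k σ') (m≤n⇒m⊓n≡m k≤l)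

suc-upTo-∷ʳ : ∀ m → map suc (upTo (suc m)) ≡ map suc (upTo m) ++ [ suc m ]
suc-upTo-∷ʳ m = trans (cong (map suc) (sym (upTo-∷ʳ m))) (map-++ suc (upTo m) [ m ])

IsPerm-length : ∀ {m σ} → IsPerm m σ → length σ ≡ m
IsPerm-length {m} σ↭ = trans (↭-length σ↭) (trans (length-map suc (upTo m)) (length-upTo m))

IsPerm-‼≤ : ∀ {m σ} → IsPerm m σ → ∀ {i} → 1 ≤ i → i ≤ m → σ ‼ i ≤ m
IsPerm-‼≤ {m} {σ} σ↭ 1≤i i≤m
  with ∈-map⁻ suc (∈-resp-↭ σ↭ (‼-∈ σ 1≤i (subst (_ ≤_) (sym (IsPerm-length σ↭)) i≤m)))
... | j , j∈ , σi≡1+j = subst (_≤ m) (sym σi≡1+j) (∈-upTo⁻ j∈)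

IsPerm-insert : ∀ {m} xs ys → IsPerm m (xs ++ ys) → IsPerm (suc m) (xs ++ suc m ∷ ys)
IsPerm-insert {m} xs ys σ↭ =
  ↭-trans (shift (suc m) xs ys)
          (↭-trans (prep (suc m) σ↭)
                   (↭-trans (++-comm [ suc m ] (map suc (upTo m))) (↭-reflexive (sym (suc-upTo-∷ʳ m)))))

IsPerm-delete : ∀ {m σ} → IsPerm (suc m) σ →
                Σ (List ℕ) λ xs → Σ (List ℕ) λ ys → σ ≡ xs ++ suc m ∷ ys × IsPerm m (xs ++ ys)
IsPerm-delete {m} {σ} σ↭ with ∈-∃++ (∈-resp-↭ (↭-sym σ↭) m+1∈)
  where
    m+1∈ : suc m ∈ map suc (upTo (suc m))
    m+1∈ = ∈-map⁺ suc (∈-upTo⁺ ≤-refl)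
... | xs , ys , refl =
  xs , ys , refl ,
  subst (xs ++ ys ↭_) (++-identityʳ _) (drop-mid xs (map suc (upTo m)) (↭-trans σ↭ (↭-reflexive (suc-upTo-∷ʳ m))))

-- Diagonals and Δ

diag≡⇒+≡ : ∀ a b c d → (+ a ℤ.- + b) ℤ.+ ℤ.1ℤ ≡ (+ c ℤ.- + d) ℤ.+ ℤ.1ℤ → a + d ≡ c + b
diag≡⇒+≡ a b c d diag≡ = ℤ.+-injective (begin
    + a ℤ.+ + d
  ≡⟨ unshift (+ a) (+ b) (+ d) ⟩
    ((+ a ℤ.- + b) ℤ.+ ℤ.1ℤ) ℤ.+ (+ b ℤ.+ + d) ℤ.- ℤ.1ℤ
  ≡⟨ cong (λ x → x ℤ.+ (+ b ℤ.+ + d) ℤ.- ℤ.1ℤ) diag≡ ⟩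
    ((+ c ℤ.- + d) ℤ.+ ℤ.1ℤ) ℤ.+ (+ b ℤ.+ + d) ℤ.- ℤ.1ℤ
  ≡⟨ reshift (+ c) (+ b) (+ d) ⟩
    + c ℤ.+ + b ∎)
  where
    open ≡-Reasoning
    unshift : ∀ x y z → x ℤ.+ z ≡ ((x ℤ.- y) ℤ.+ ℤ.1ℤ) ℤ.+ (y ℤ.+ z) ℤ.- ℤ.1ℤ
    unshift = ℤ-Solver.solve-∀
    reshift : ∀ x y z → ((x ℤ.- z) ℤ.+ ℤ.1ℤ) ℤ.+ (y ℤ.+ z) ℤ.- ℤ.1ℤ ≡ x ℤ.+ y
    reshift = ℤ-Solver.solve-∀

-- i - s i is strictly increasing in the row index i.
diagOf-injective : ∀ {s n} → Shape s n → ∀ {i i'} → 1 ≤ i → 1 ≤ i' → diagOfᶠ s i ≡ diagOfᶠ s i' → i ≡ i'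
diagOf-injective {s} sh {i} {i'} 1≤i 1≤i' same with <-cmp i i'
... | tri≈ _ i≡i' _ = i≡i'
... | tri< i<i' _ _ =
  ⊥-elim (<-irrefl (diag≡⇒+≡ i (s i) i' (s i') same) (+-mono-<-≤ i<i' (antitone sh 1≤i (<⇒≤ i<i'))))
... | tri> _ _ i'<i =
  ⊥-elim (<-irrefl (sym (diag≡⇒+≡ i (s i) i' (s i') same)) (+-mono-<-≤ i'<i (antitone sh 1≤i' (<⇒≤ i'<i))))

i-a≡[1+i]-[1+a] : ∀ a b → + a ℤ.- + b ≡ + suc a ℤ.- + suc b
i-a≡[1+i]-[1+a] a b = add-one (+ a) (+ b)
  where
    add-one : ∀ x y → x ℤ.- y ≡ (ℤ.1ℤ ℤ.+ x) ℤ.- (ℤ.1ℤ ℤ.+ y)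
    add-one = ℤ-Solver.solve-∀

[a+x]-i≡x-[i-a] : ∀ a x i → (+ a ℤ.+ + x) ℤ.- + i ≡ + x ℤ.- (+ i ℤ.- + a)
[a+x]-i≡x-[i-a] a x i = regroup (+ a) (+ x) (+ i)
  where
    regroup : ∀ a x i → (a ℤ.+ x) ℤ.- i ≡ x ℤ.- (i ℤ.- a)
    regroup = ℤ-Solver.solve-∀

Δ-vanishes : ∀ a x i → + x ≡ + i ℤ.- + a → (+ a ℤ.+ + x) ℤ.- + i ≡ ℤ.0ℤ
Δ-vanishes a x i x≡ = trans ([a+x]-i≡x-[i-a] a x i) (trans (cong (ℤ._- (+ i ℤ.- + a)) x≡) (ℤ.+-inverseʳ (+ i ℤ.- + a)))

[a+n]-t≡h : ∀ {h t a n} → h + t ≡ a + n → (+ a ℤ.+ + n) ℤ.- + t ≡ + h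
[a+n]-t≡h {h} {t} h+t≡ = trans (cong (λ x → + x ℤ.- + t) (sym h+t≡)) (cancel (+ h) (+ t))
  where
    cancel : ∀ h t → (h ℤ.+ t) ℤ.- t ≡ h
    cancel = ℤ-Solver.solve-∀

0≤[a+x]-i⇒i≤a+x : ∀ a x i → ℤ.0ℤ ℤ.≤ (+ a ℤ.+ + x) ℤ.- + i → i ≤ a + x
0≤[a+x]-i⇒i≤a+x a x i 0≤Δ = ℤ.drop‿+≤+ (ℤ.0≤i-j⇒j≤i 0≤Δ)

n≡i-a⇒i≡n+a : ∀ {n i a} → + n ≡ + i ℤ.- + a → i ≡ n + a
n≡i-a⇒i≡n+a {n} {i} {a} n≡ = ℤ.+-injective (trans (sym (cancel (+ i) (+ a))) (cong (ℤ._+ + a) (sym n≡)))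
  where
    cancel : ∀ i a → (i ℤ.- a) ℤ.+ a ≡ i
    cancel = ℤ-Solver.solve-∀

GammaIs-from-PermRow : ∀ {s n} (R : SRTᶠ s) {σ i} → PermRowᶠ R σ i →
                       (∀ c → InitialOnRowᶠ R i c → Δᶠ s σ i ≡ + hookSizeᶠ n R c) → GammaIsᶠ n R i (Δᶠ s σ i)
GammaIs-from-PermRow {s} R {σ} {i} (no-initial , _) sized =
  (λ none → Δ-vanishes (s i) (σ ‼ i) i (no-initial none)) , sized

-- Removing the bottom hook

-- Rows above t are kept and row i + 1 > t becomes row i, so every row i ≢ t of s has a
-- partner row i' of μ on the same diagonal.
module Removal {s : ℕ → ℕ} {n' : ℕ} (sh : Shape s (suc n')) {t : ℕ} (1≤t : 1 ≤ t) (t≤n : t ≤ suc n')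
               (below-t-nonempty : ∀ {i} → t < i → i ≤ suc n' → 1 ≤ s i) where
  n : ℕ
  n = suc n'
  open RemovedDiagram sh t public

  μ-shape : Shape μ n'
  μ-shape = removeBottomHook-shape sh 1≤t t≤n

  μ≤s : ∀ {i} → 1 ≤ i → μ i ≤ s i
  μ≤s {i} 1≤i with <-≤-connex i t
  ... | inj₁ i<t = ≤-reflexive (removeBottomHook-above i<t)
  ... | inj₂ t≤i = ≤-trans (≤-reflexive (removeBottomHook-below t≤i)) (≤-trans pred[n]≤n (antitone sh 1≤i (n≤1+n i)))

  suc-μ : ∀ {i} → t ≤ i → i ≤ n' → suc (μ i) ≡ s (suc i)
  suc-μ {i} t≤i i≤n' with s (suc i) | below-t-nonempty (s≤s t≤i) (s≤s i≤n') | removeBottomHook-below {s} {t} {i} t≤i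
  ... | suc _ | _ | μi≡ = cong suc μi≡

  empty-last⇒t≡n : s n ≡ 0 → t ≡ n
  empty-last⇒t≡n sn≡0 with m≤n⇒m<n∨m≡n t≤n
  ... | inj₂ t≡n = t≡n
  ... | inj₁ t<n = ⊥-elim (<⇒≱ (below-t-nonempty t<n ≤-refl) (≤-reflexive sn≡0))

  empty-top⇒t≡n : s t ≡ 0 → t ≡ n
  empty-top⇒t≡n st≡0 = empty-last⇒t≡n (n≤0⇒n≡0 (subst (s n ≤_) st≡0 (antitone sh 1≤t t≤n)))

  empty-top-offset : s t ≡ 0 → + t ℤ.- + s t ≡ + n
  empty-top-offset st≡0 = begin
      + t ℤ.- + s t
    ≡⟨ cong₂ (λ a b → + a ℤ.- + b) (empty-top⇒t≡n st≡0) st≡0 ⟩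
      + n ℤ.- + 0
    ≡⟨ ℤ.+-identityʳ (+ n) ⟩
      + n ∎
    where open ≡-Reasoning

  top-end∈bottomHook : 1 ≤ s t → BottomHook s t (t , s t)
  top-end∈bottomHook 1≤st = (1≤t , 1≤st , ≤-refl) , ≤-refl , antitone sh 1≤t (n≤1+n t)

  corner∈bottomHook : ∀ {c} → BottomHook s t c → BottomHook s t (n , 1)
  corner∈bottomHook {i , j} (i∈@(_ , 1≤j , j≤si) , t≤i , _) =
    (s≤s z≤n , s≤s z≤n , 1≤sn) , t≤n , subst (_≤ 1) (sym (vanishes sh ≤-refl)) z≤n
    where
      1≤sn : 1 ≤ s n
      1≤sn with m≤n⇒m<n∨m≡n (row≤bound sh i∈)
      ... | inj₁ i<n = below-t-nonempty (≤-<-trans t≤i i<n) ≤-refl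
      ... | inj₂ refl = ≤-trans 1≤j j≤si

  record RowMatch (i i' : ℕ) : Set where
    field
      1≤i : 1 ≤ i
      i≤n : i ≤ n
      i≢t : i ≢ t
      1≤i' : 1 ≤ i'
      i'≤n' : i' ≤ n'
      same-offset : + i' ℤ.- + μ i' ≡ + i ℤ.- + s i
      same-entry : ∀ {σ σ'} → Deletion t n σ σ' → σ' ‼ i' ≡ σ ‼ i

    same-diag : diagOfᶠ μ i' ≡ diagOfᶠ s i
    same-diag = cong (ℤ._+ ℤ.1ℤ) same-offset

  match-above : ∀ {i} → 1 ≤ i → i < t → RowMatch i i
  match-above {i} 1≤i i<t = record
    { 1≤i = 1≤i ; i≤n = ≤-trans (<⇒≤ i<t) t≤n ; i≢t = <⇒≢ i<t
    ; 1≤i' = 1≤i ; i'≤n' = ≤-pred (≤-trans i<t t≤n)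
    ; same-offset = cong (λ x → + i ℤ.- + x) (removeBottomHook-above i<t)
    ; same-entry = λ del → Deletion.before del 1≤i i<t }

  match-below : ∀ {i} → t ≤ i → i ≤ n' → RowMatch (suc i) i
  match-below {i} t≤i i≤n' = record
    { 1≤i = s≤s z≤n ; i≤n = s≤s i≤n' ; i≢t = λ i+1≡t → <⇒≢ (s≤s t≤i) (sym i+1≡t)
    ; 1≤i' = ≤-trans 1≤t t≤i ; i'≤n' = i≤n'
    ; same-offset = trans (i-a≡[1+i]-[1+a] i (μ i)) (cong (λ x → + suc i ℤ.- + x) (suc-μ t≤i i≤n'))
    ; same-entry = λ del → Deletion.after del t≤i }

  match-row : ∀ {i} → 1 ≤ i → i ≤ n → i ≢ t → Σ ℕ (RowMatch i)
  match-row {i} 1≤i i≤n i≢t with <-cmp i t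
  ... | tri< i<t _ _ = i , match-above 1≤i i<t
  ... | tri≈ _ i≡t _ = ⊥-elim (i≢t i≡t)
  match-row {suc i} 1≤i (s≤s i≤n') i≢t | tri> _ _ (s≤s t≤i) = i , match-below t≤i i≤n'

  match-row′ : ∀ {i'} → 1 ≤ i' → i' ≤ n' → Σ ℕ λ i → RowMatch i i'
  match-row′ {i'} 1≤i' i'≤n' with <-≤-connex i' t
  ... | inj₁ i'<t = i' , match-above 1≤i' i'<t
  ... | inj₂ t≤i' = suc i' , match-below t≤i' i'≤n'

  Δ-match : ∀ {i i' σ σ'} → RowMatch i i' → Deletion t n σ σ' → Δᶠ μ σ' i' ≡ Δᶠ s σ i
  Δ-match {i} {i'} {σ} {σ'} m del = begin
      Δᶠ μ σ' i'
    ≡⟨ [a+x]-i≡x-[i-a] (μ i') (σ' ‼ i') i' ⟩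
      + (σ' ‼ i') ℤ.- (+ i' ℤ.- + μ i')
    ≡⟨ cong₂ (λ x y → + x ℤ.- y) (RowMatch.same-entry m del) (RowMatch.same-offset m) ⟩
      + (σ ‼ i) ℤ.- (+ i ℤ.- + s i)
    ≡⟨ sym ([a+x]-i≡x-[i-a] (s i) (σ ‼ i) i) ⟩
      Δᶠ s σ i ∎
    where open ≡-Reasoning

  Δ-top : ∀ {σ σ'} → Deletion t n σ σ' → Δᶠ s σ t ≡ + (s t + n ∸ t)
  Δ-top {σ} del = trans (cong (λ x → (+ s t ℤ.+ + x) ℤ.- + t) (Deletion.deleted del))
                        ([a+n]-t≡h {a = s t} {n} (m∸n+n≡m (≤-trans t≤n (m≤n+m n (s t)))))

  NonNegΔ-lift : ∀ {σ σ'} → Deletion t n σ σ' → NonNegΔᶠ μ n' σ' → NonNegΔᶠ s n σ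
  NonNegΔ-lift del nonneg' i 1≤i i≤n with i ≟ t
  ... | yes refl = subst (ℤ.0ℤ ℤ.≤_) (sym (Δ-top del)) (ℤ.+≤+ z≤n)
  ... | no i≢t = subst (ℤ.0ℤ ℤ.≤_) (Δ-match m del) (nonneg' i' (RowMatch.1≤i' m) (RowMatch.i'≤n' m))
    where
      i' = proj₁ (match-row 1≤i i≤n i≢t)
      m = proj₂ (match-row 1≤i i≤n i≢t)

  NonNegΔ-lower : ∀ {σ σ'} → Deletion t n σ σ' → NonNegΔᶠ s n σ → NonNegΔᶠ μ n' σ'
  NonNegΔ-lower del nonneg i' 1≤i' i'≤n' =
    subst (ℤ.0ℤ ℤ.≤_) (sym (Δ-match m del)) (nonneg i (RowMatch.1≤i m) (RowMatch.i≤n m))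
    where
      i = proj₁ (match-row′ 1≤i' i'≤n')
      m = proj₂ (match-row′ 1≤i' i'≤n')

module Restriction {s : ℕ → ℕ} {n' : ℕ} (sh : Shape s (suc n')) {t : ℕ} (1≤t : 1 ≤ t) (t≤n : t ≤ suc n')
  (below-t-nonempty : ∀ {i} → t < i → i ≤ suc n' → 1 ≤ s i)
  (R : SRTᶠ s) (R' : SRTᶠ (removeBottomHook s t))
  (bottom : IsHookOf R (BottomHook s t))
  (agree : ∀ {c} → InDiagramᶠ (removeBottomHook s t) c → hookOfᶠ R c ≐ hookOfᶠ R' c) where
  open Removal sh 1≤t t≤n below-t-nonempty

  initial-of-bottomHook : ∀ {c} → BottomHook s t c → Initial (hookOfᶠ R c) c → c ≡ (t , s t)
  initial-of-bottomHook {i , j} hc@((_ , 1≤j , j≤si) , t≤i , _) (_ , extreme) =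
    cong₂ _,_ i≡t (≤-antisym (subst (λ r → j ≤ s r) i≡t j≤si) (proj₂ top-end-extreme))
    where
      1≤st = ≤-trans 1≤j (≤-trans j≤si (antitone sh 1≤t t≤i))
      top-end-extreme = extreme (t , s t) (proj₂ (bottom hc) (top-end∈bottomHook 1≤st))
      i≡t : i ≡ t
      i≡t = ≤-antisym (proj₁ top-end-extreme) t≤i

  corner-terminal : ∀ {c} → BottomHook s t c → Terminal (hookOfᶠ R c) (n , 1)
  corner-terminal hc =
    proj₂ (bottom hc) (corner∈bottomHook hc) ,
    λ d hd → row≤bound sh (proj₁ hd) , proj₁ (proj₂ (proj₁ hd))

  terminal-row : ∀ {c τ} → BottomHook s t c → Terminal (hookOfᶠ R c) τ → row τ ≡ n
  terminal-row hc (hτ , extreme) =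
    ≤-antisym (row≤bound sh (proj₁ hτ)) (proj₁ (extreme (n , 1) (proj₁ (corner-terminal hc))))

  top-end-initial : 1 ≤ s t → InitialOnRowᶠ R t (t , s t)
  top-end-initial 1≤st = proj₁ top-end , (proj₂ (bottom top-end) top-end , below) , refl
    where
      top-end = top-end∈bottomHook 1≤st
      below : ∀ d → hookOfᶠ R (t , s t) d → t ≤ row d × col d ≤ s t
      below (i , j) hd with proj₁ (bottom top-end) hd
      ... | (1≤i , _ , j≤si) , t≤i , _ = t≤i , ≤-trans j≤si (antitone sh 1≤t t≤i)

  initial-lift : ∀ {i i' c} → RowMatch i i' → InitialOnRowᶠ R' i' c → InitialOnRowᶠ R i c
  initial-lift m (c∈μ , initial , on-diag) =
    removed⊆diagram c∈μ , Initial-resp-≐ (≐-sym (agree c∈μ)) initial , trans on-diag (RowMatch.same-diag m)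

  initial-off-bottom : ∀ {i c} → 1 ≤ i → i ≢ t → InitialOnRowᶠ R i c → ¬ BottomHook s t c
  initial-off-bottom 1≤i i≢t (_ , initial , on-diag) hc with initial-of-bottomHook hc initial
  ... | refl = i≢t (diagOf-injective sh 1≤i 1≤t (sym on-diag))

  initial-lower : ∀ {i i' c} → RowMatch i i' → InitialOnRowᶠ R i c → InitialOnRowᶠ R' i' c
  initial-lower m ior@(c∈ , initial , on-diag) =
    c∈μ , Initial-resp-≐ (agree c∈μ) initial , trans on-diag (sym (RowMatch.same-diag m))
    where
      c∈μ = diagram∖bottomHook⊆removed c∈ (initial-off-bottom (RowMatch.1≤i m) (RowMatch.i≢t m) ior)

  initial-on-top-row : InitialCellsOnDiagonals n' R' → ∀ {c} → InitialOnRowᶠ R t c → BottomHook s t c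
  initial-on-top-row on-diagonals' {c} (c∈ , initial , on-diag) with BottomHook? s t c
  ... | yes hc = hc
  ... | no ¬hc with on-diagonals' c c∈μ (Initial-resp-≐ (agree c∈μ) initial)
    where c∈μ = diagram∖bottomHook⊆removed c∈ ¬hc
  ...   | i' , 1≤i' , i'≤n' , on-diag' =
    ⊥-elim (RowMatch.i≢t m (diagOf-injective sh (RowMatch.1≤i m) 1≤t
                              (trans (sym (RowMatch.same-diag m)) (trans (sym on-diag') on-diag))))
    where m = proj₂ (match-row′ 1≤i' i'≤n')

  hookSize-removed : ∀ {c} → InDiagramᶠ μ c → hookSizeᶠ n R c ≡ hookSizeᶠ n' R' c
  hookSize-removed {c} c∈μ = begin
      count same-hook? (cellsᶠ s n)
    ≡⟨ count-cells-drop-row s n' (λ j<sn → off-bottom (last-row j<sn)) ⟩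
      count same-hook? (cellsᶠ s n')
    ≡⟨ count-cells-shrink s μ n' (λ 1≤i _ → μ≤s 1≤i) outside-μ ⟩
      count same-hook? (cellsᶠ μ n')
    ≡⟨ count-cells-cong same-hook? same-hook'? μ n' same-hooks ⟩
      count same-hook'? (cellsᶠ μ n') ∎
    where
      open ≡-Reasoning
      open Counting (λ d → labelᶠ R d ≟ labelᶠ R c)
      same-hook? = λ d → labelᶠ R d ≟ labelᶠ R c
      same-hook'? = λ d → labelᶠ R' d ≟ labelᶠ R' c
      off-bottom : ∀ {d} → BottomHook s t d → labelᶠ R d ≢ labelᶠ R c
      off-bottom hd Ld≡Lc = removed-avoids-bottomHook c∈μ (proj₁ (bottom hd) (removed⊆diagram c∈μ , sym Ld≡Lc))
      last-row : ∀ {j} → j < s n → BottomHook s t (n , suc j)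
      last-row j<sn = (s≤s z≤n , s≤s z≤n , j<sn) , t≤n , subst (_≤ suc _) (sym (vanishes sh ≤-refl)) z≤n
      outside-μ : ∀ {i j} → 1 ≤ i → i ≤ n' → μ i ≤ j → j < s i → labelᶠ R (i , suc j) ≢ labelᶠ R c
      outside-μ {i} {j} 1≤i _ μi≤j j<si with BottomHook? s t (i , suc j)
      ... | yes hd = off-bottom hd
      ... | no ¬hd =
        ⊥-elim (<⇒≱ (s≤s μi≤j) (proj₂ (proj₂ (diagram∖bottomHook⊆removed (1≤i , s≤s z≤n , j<si) ¬hd))))
      same-hooks : ∀ {d} → InDiagramᶠ μ d → (labelᶠ R d ≡ labelᶠ R c → labelᶠ R' d ≡ labelᶠ R' c) ×
                                              (labelᶠ R' d ≡ labelᶠ R' c → labelᶠ R d ≡ labelᶠ R c)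
      same-hooks d∈μ = (λ Ld≡Lc → proj₂ (proj₁ (agree c∈μ) (removed⊆diagram d∈μ , Ld≡Lc))) ,
                       (λ L'd≡L'c → proj₂ (proj₂ (agree c∈μ) (d∈μ , L'd≡L'c)))

  hookSize-bottom : ∀ {c} → BottomHook s t c → hookSizeᶠ n R c + t ≡ s t + n
  hookSize-bottom {c} hc =
    trans (cong (_+ t) (count-cells-cong (λ d → labelᶠ R d ≟ labelᶠ R c) (BottomHook? s t) s n same-cells))
          (BottomHookSize.bottomHook-size sh 1≤sn 1≤t t≤n)
    where
      1≤sn = proj₂ (proj₂ (proj₁ (corner∈bottomHook hc)))
      same-cells : ∀ {d} → InDiagramᶠ s d → (labelᶠ R d ≡ labelᶠ R c → BottomHook s t d) ×
                                             (BottomHook s t d → labelᶠ R d ≡ labelᶠ R c)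
      same-cells d∈ = (λ Ld≡Lc → proj₁ (bottom hc) (d∈ , Ld≡Lc)) , (λ hd → proj₂ (proj₂ (bottom hc) hd))

  module _ {σ σ' : List ℕ} (del : Deletion t n σ σ') where
    open RowMatch

    perm-row-lift : ∀ {i i'} → RowMatch i i' → PermRowᶠ R' σ' i' → PermRowᶠ R σ i
    perm-row-lift {i} m (no-initial' , terminal') = no-initial , terminal
      where
        no-initial : (∀ c → ¬ InitialOnRowᶠ R i c) → + (σ ‼ i) ≡ + i ℤ.- + s i
        no-initial none = subst₂ (λ x y → + x ≡ y) (same-entry m del) (same-offset m)
                                 (no-initial' λ c ior' → none c (initial-lift m ior'))
        terminal : ∀ c τ → InitialOnRowᶠ R i c → Terminal (hookOfᶠ R c) τ → σ ‼ i ≡ row τ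
        terminal c τ ior term = trans (sym (same-entry m del))
          (terminal' c τ (initial-lower m ior) (Terminal-resp-≐ (agree (proj₁ (initial-lower m ior))) term))

    perm-row-lower : ∀ {i i'} → RowMatch i i' → PermRowᶠ R σ i → PermRowᶠ R' σ' i'
    perm-row-lower {i} {i'} m (no-initial , terminal) = no-initial' , terminal'
      where
        no-initial' : (∀ c → ¬ InitialOnRowᶠ R' i' c) → + (σ' ‼ i') ≡ + i' ℤ.- + μ i'
        no-initial' none' = subst₂ (λ x y → + x ≡ y) (sym (same-entry m del)) (sym (same-offset m))
                                   (no-initial λ c ior → none' c (initial-lower m ior))
        terminal' : ∀ c τ → InitialOnRowᶠ R' i' c → Terminal (hookOfᶠ R' c) τ → σ' ‼ i' ≡ row τ
        terminal' c τ ior' term' = trans (same-entry m del)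
          (terminal c τ (initial-lift m ior') (Terminal-resp-≐ (≐-sym (agree (proj₁ ior'))) term'))

    perm-row-top : InitialCellsOnDiagonals n' R' → PermRowᶠ R σ t
    perm-row-top on-diagonals' = no-initial , terminal
      where
        no-initial : (∀ c → ¬ InitialOnRowᶠ R t c) → + (σ ‼ t) ≡ + t ℤ.- + s t
        no-initial none with s t ≟ 0
        ... | no st≢0 = ⊥-elim (none (t , s t) (top-end-initial (n≢0⇒n>0 st≢0)))
        ... | yes st≡0 = trans (cong +_ (Deletion.deleted del)) (sym (empty-top-offset st≡0))
        terminal : ∀ c τ → InitialOnRowᶠ R t c → Terminal (hookOfᶠ R c) τ → σ ‼ t ≡ row τ
        terminal c τ ior term =
          trans (Deletion.deleted del) (sym (terminal-row (initial-on-top-row on-diagonals' ior) term))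

    gamma-row-lift : ∀ {i i'} → RowMatch i i' → PermRowᶠ R σ i → GammaIsᶠ n' R' i' (Δᶠ μ σ' i') →
                     GammaIsᶠ n R i (Δᶠ s σ i)
    gamma-row-lift m perm (_ , sized') = GammaIs-from-PermRow {n = n} R {σ} perm λ c ior →
      trans (sym (Δ-match m del))
            (trans (sized' c (initial-lower m ior)) (cong +_ (sym (hookSize-removed (proj₁ (initial-lower m ior))))))

    gamma-row-top : InitialCellsOnDiagonals n' R' → PermRowᶠ R σ t → GammaIsᶠ n R t (Δᶠ s σ t)
    gamma-row-top on-diagonals' perm = GammaIs-from-PermRow {n = n} R {σ} perm λ c ior →
      trans (cong (λ x → (+ s t ℤ.+ + x) ℤ.- + t) (Deletion.deleted del))
            ([a+n]-t≡h {a = s t} {n} (hookSize-bottom (initial-on-top-row on-diagonals' ior)))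

    perm-lift : InitialCellsOnDiagonals n' R' → PermSRTᶠ n' R' σ' → PermSRTᶠ n R σ
    perm-lift on-diagonals' perm' i 1≤i i≤n with i ≟ t
    ... | yes refl = perm-row-top on-diagonals'
    ... | no i≢t = perm-row-lift m (perm' _ (1≤i' m) (i'≤n' m))
      where m = proj₂ (match-row 1≤i i≤n i≢t)

    perm-lower : PermSRTᶠ n R σ → PermSRTᶠ n' R' σ'
    perm-lower perm i' 1≤i' i'≤n' = perm-row-lower m (perm _ (1≤i m) (i≤n m))
      where m = proj₂ (match-row′ 1≤i' i'≤n')

    gamma-lift : InitialCellsOnDiagonals n' R' → PermSRTᶠ n R σ → GammaΔᶠ n' R' σ' → GammaΔᶠ n R σ
    gamma-lift on-diagonals' perm gamma' i 1≤i i≤n with i ≟ t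
    ... | yes refl = gamma-row-top on-diagonals' (perm t 1≤i i≤n)
    ... | no i≢t = gamma-row-lift m (perm i 1≤i i≤n) (gamma' _ (1≤i' m) (i'≤n' m))
      where m = proj₂ (match-row 1≤i i≤n i≢t)

  top-entry : InitialCellsOnDiagonals n' R' → ∀ {σ} → PermSRTᶠ n R σ → σ ‼ t ≡ n
  top-entry on-diagonals' perm with s t ≟ 0
  ... | no st≢0 = proj₂ (perm t 1≤t t≤n) _ _ (top-end-initial 1≤st) (corner-terminal (top-end∈bottomHook 1≤st))
    where 1≤st = n≢0⇒n>0 st≢0
  ... | yes st≡0 = ℤ.+-injective (trans (proj₁ (perm t 1≤t t≤n) none) (empty-top-offset st≡0))
    where
      none : ∀ c → ¬ InitialOnRowᶠ R t c
      none c ior = empty-top⇒no-bottomHook sh 1≤t st≡0 (initial-on-top-row on-diagonals' ior)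

  initial-on-diagonals-lift : InitialCellsOnDiagonals n' R' → InitialCellsOnDiagonals n R
  initial-on-diagonals-lift on-diagonals' c c∈ initial with BottomHook? s t c
  ... | yes hc = t , 1≤t , t≤n , subst (OnDiag (diagOfᶠ s t)) (sym (initial-of-bottomHook hc initial)) refl
  ... | no ¬hc with on-diagonals' c c∈μ (Initial-resp-≐ (agree c∈μ) initial)
    where c∈μ = diagram∖bottomHook⊆removed c∈ ¬hc
  ...   | i' , 1≤i' , i'≤n' , on-diag' =
    i , RowMatch.1≤i m , RowMatch.i≤n m , trans on-diag' (RowMatch.same-diag m)
    where
      i = proj₁ (match-row′ 1≤i' i'≤n')
      m = proj₂ (match-row′ 1≤i' i'≤n')

  has-terminal-lift : HooksHaveTerminal R' → HooksHaveTerminal R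
  has-terminal-lift has-terminal' c c∈ with BottomHook? s t c
  ... | yes hc = (n , 1) , corner-terminal hc
  ... | no ¬hc = proj₁ (has-terminal' c c∈μ) , Terminal-resp-≐ (≐-sym (agree c∈μ)) (proj₂ (has-terminal' c c∈μ))
    where c∈μ = diagram∖bottomHook⊆removed c∈ ¬hc

  -- The entry n of perm_SRT(R) sits in row t; otherwise row i would either be fixed by
  -- i - s i = n, forcing i = t = n, or end in a hook that stays inside the rows of μ.
  entry-n⇒top : HooksHaveTerminal R' → ∀ {σ} → PermSRTᶠ n R σ →
                ∀ {i} → 1 ≤ i → i ≤ n → σ ‼ i ≡ n → i ≡ t
  entry-n⇒top has-terminal' {σ} perm {i} 1≤i i≤n σi≡n with i ≟ t
  ... | yes i≡t = i≡t
  ... | no i≢t = ⊥-elim (some-initial no-initial)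
    where
      no-initial : ∀ c → ¬ InitialOnRowᶠ R i c
      no-initial c ior = 1+n≰n (subst (_≤ n') (trans (sym σi≡row) σi≡n) (row≤bound μ-shape (proj₁ (proj₁ term'))))
        where
          c∈μ = diagram∖bottomHook⊆removed (proj₁ ior) (initial-off-bottom 1≤i i≢t ior)
          τ = proj₁ (has-terminal' c c∈μ)
          term' = proj₂ (has-terminal' c c∈μ)
          σi≡row = proj₂ (perm i 1≤i i≤n) c τ ior (Terminal-resp-≐ (≐-sym (agree c∈μ)) term')
      some-initial : ¬ (∀ c → ¬ InitialOnRowᶠ R i c)
      some-initial none with n≡i-a⇒i≡n+a (trans (cong +_ (sym σi≡n)) (proj₁ (perm i 1≤i i≤n) none))
      ... | i≡n+si = i≢t (trans i≡n (sym (empty-last⇒t≡n (subst (λ r → s r ≡ 0) i≡n si≡0))))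
        where
          si≡0 : s i ≡ 0
          si≡0 = n≤0⇒n≡0 (+-cancelˡ-≤ n (s i) 0
                   (≤-trans (≤-reflexive (sym i≡n+si)) (≤-trans i≤n (≤-reflexive (sym (+-identityʳ n))))))
          i≡n : i ≡ n
          i≡n = trans i≡n+si (trans (cong (_+_ n) si≡0) (+-identityʳ n))

-- Induction on the number of rows

record Encoding {s : ℕ → ℕ} (n : ℕ) (R : SRTᶠ s) (σ : List ℕ) : Set where
  field
    isPerm : IsPerm n σ
    perm : PermSRTᶠ n R σ
    nonNeg : NonNegΔᶠ s n σ
    gamma : GammaΔᶠ n R σ

record Correspondence (s : ℕ → ℕ) (n : ℕ) : Set where
  field
    encode : (R : SRTᶠ s) → Σ (List ℕ) (Encoding n R)
    initial-on-diagonals : (R : SRTᶠ s) → InitialCellsOnDiagonals n R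
    has-terminal : (R : SRTᶠ s) → HooksHaveTerminal R
    injective : ∀ (R R' : SRTᶠ s) σ → PermSRTᶠ n R σ → PermSRTᶠ n R' σ → SamePartitionᶠ R R'
    surjective : ∀ σ → IsPerm n σ → NonNegΔᶠ s n σ → Σ (SRTᶠ s) λ R → PermSRTᶠ n R σ

module Step {s : ℕ → ℕ} {n' : ℕ} (sh : Shape s (suc n')) {t : ℕ} (1≤t : 1 ≤ t) (t≤n : t ≤ suc n')
  (below-t-nonempty : ∀ {i} → t < i → i ≤ suc n' → 1 ≤ s i)
  (IH : Correspondence (removeBottomHook s t) n') where
  open Removal sh 1≤t t≤n below-t-nonempty
  module IH = Correspondence IH

  module _ (R : SRTᶠ s) (bottom : IsHookOf R (BottomHook s t)) where
    restrict-agrees : ∀ {c} → InDiagramᶠ μ c → hookOfᶠ R c ≐ Blockᶠ μ (labelᶠ R) (labelᶠ R c)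
    restrict-agrees c∈μ =
      (λ (d∈ , Ld≡Lc) → diagram∖bottomHook⊆removed d∈
                          (IsHookOf⇒disjoint {R = R} bottom (removed⊆diagram c∈μ) (removed-avoids-bottomHook c∈μ)
                                             (d∈ , Ld≡Lc)) ,
                        Ld≡Lc) ,
      (λ (d∈μ , Ld≡Lc) → removed⊆diagram d∈μ , Ld≡Lc)

    restrict : SRTᶠ μ
    restrict = record
      { labelᶠ = labelᶠ R
      ; hooksᶠ = λ c c∈μ → let (rim , r , r1∈) = hooksᶠ R c (removed⊆diagram c∈μ) in
          IsRimHook-resp-≐ (restrict-agrees c∈μ) rim , r , proj₁ (restrict-agrees c∈μ) r1∈
      }

    open Restriction sh 1≤t t≤n below-t-nonempty R restrict bottom restrict-agrees

    perm-top-entry : ∀ {σ} → PermSRTᶠ (suc n') R σ → σ ‼ t ≡ suc n'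
    perm-top-entry {σ} = top-entry (IH.initial-on-diagonals restrict) {σ}

    perm-entry-n⇒top : ∀ {σ} → PermSRTᶠ (suc n') R σ → ∀ {i} → 1 ≤ i → i ≤ suc n' → σ ‼ i ≡ suc n' → i ≡ t
    perm-entry-n⇒top {σ} = entry-n⇒top (IH.has-terminal restrict) {σ}

    perm-restrict : ∀ {σ σ'} → Deletion t (suc n') σ σ' → PermSRTᶠ (suc n') R σ → PermSRTᶠ n' restrict σ'
    perm-restrict = perm-lower

    encode : Σ (List ℕ) (Encoding (suc n') R) × InitialCellsOnDiagonals (suc n') R × HooksHaveTerminal R
    encode = (xs ++ suc n' ∷ ys , encoding) , initial-on-diagonals-lift on-diagonals' , has-terminal-lift (IH.has-terminal restrict)
      where
        σ' = proj₁ (IH.encode restrict)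
        module E' = Encoding (proj₂ (IH.encode restrict))
        on-diagonals' = IH.initial-on-diagonals restrict
        split = insertion (suc n') σ' 1≤t (subst (λ l → t ≤ suc l) (sym (IsPerm-length E'.isPerm)) t≤n)
        xs = proj₁ split
        ys = proj₁ (proj₂ split)
        del = proj₂ (proj₂ (proj₂ split))
        encoding : Encoding (suc n') R (xs ++ suc n' ∷ ys)
        encoding = record
          { isPerm = IsPerm-insert xs ys (subst (IsPerm n') (proj₁ (proj₂ (proj₂ split))) E'.isPerm)
          ; perm = perm-lift del on-diagonals' E'.perm
          ; nonNeg = NonNegΔ-lift del E'.nonNeg
          ; gamma = gamma-lift del on-diagonals' (perm-lift del on-diagonals' E'.perm) E'.gamma
          }

  labels-on-bottomHook : ∀ (R : SRTᶠ s) → IsHookOf R (BottomHook s t) → ∀ {c d} → BottomHook s t c → InDiagramᶠ s d →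
                         (labelᶠ R c ≡ labelᶠ R d → BottomHook s t d) × (BottomHook s t d → labelᶠ R c ≡ labelᶠ R d)
  labels-on-bottomHook R bottom hc d∈ =
    (λ Lc≡Ld → proj₁ (bottom hc) (d∈ , sym Lc≡Ld)) , (λ hd → sym (proj₂ (proj₂ (bottom hc) hd)))

  injective : ∀ (R₁ R₂ : SRTᶠ s) (bottom₁ : IsHookOf R₁ (BottomHook s t)) (bottom₂ : IsHookOf R₂ (BottomHook s t)) →
              ∀ σ → PermSRTᶠ (suc n') R₁ σ → PermSRTᶠ (suc n') R₂ σ → SamePartitionᶠ R₁ R₂
  injective R₁ R₂ bottom₁ bottom₂ σ perm₁ perm₂ c d c∈ d∈ with BottomHook? s t c | BottomHook? s t d
  ... | yes hc | yes hd =
    (λ _ → proj₂ (labels-on-bottomHook R₂ bottom₂ hc d∈) hd) ,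
    (λ _ → proj₂ (labels-on-bottomHook R₁ bottom₁ hc d∈) hd)
  ... | yes hc | no ¬hd =
    (λ e → ⊥-elim (¬hd (proj₁ (labels-on-bottomHook R₁ bottom₁ hc d∈) e))) ,
    (λ e → ⊥-elim (¬hd (proj₁ (labels-on-bottomHook R₂ bottom₂ hc d∈) e)))
  ... | no ¬hc | yes hd =
    (λ e → ⊥-elim (¬hc (proj₁ (labels-on-bottomHook R₁ bottom₁ hd c∈) (sym e)))) ,
    (λ e → ⊥-elim (¬hc (proj₁ (labels-on-bottomHook R₂ bottom₂ hd c∈) (sym e))))
  ... | no ¬hc | no ¬hd =
    IH.injective (restrict R₁ bottom₁) (restrict R₂ bottom₂) σ'
                 (perm-restrict R₁ bottom₁ del perm₁) (perm-restrict R₂ bottom₂ del perm₂)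
                 c d (diagram∖bottomHook⊆removed c∈ ¬hc) (diagram∖bottomHook⊆removed d∈ ¬hd)
    where
      deletion = deletion-at σ 1≤t (s≤s z≤n) (perm-top-entry R₁ bottom₁ {σ} perm₁)
      σ' = proj₁ deletion
      del = proj₂ deletion

  module Extension (R' : SRTᶠ μ) where
    extendedLabel : Cell → ℕ
    extendedLabel c with BottomHook? s t c
    ... | yes _ = 0
    ... | no _ = suc (labelᶠ R' c)

    extendedLabel-bottom : ∀ {c} → BottomHook s t c → extendedLabel c ≡ 0
    extendedLabel-bottom {c} hc with BottomHook? s t c
    ... | yes _ = refl
    ... | no ¬hc = ⊥-elim (¬hc hc)

    extendedLabel-off : ∀ {c} → ¬ BottomHook s t c → extendedLabel c ≡ suc (labelᶠ R' c)
    extendedLabel-off {c} ¬hc with BottomHook? s t c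
    ... | yes hc = ⊥-elim (¬hc hc)
    ... | no _ = refl

    extendedLabel≡0⇒bottom : ∀ {c} → extendedLabel c ≡ 0 → BottomHook s t c
    extendedLabel≡0⇒bottom {c} Lc≡0 =
      decidable-stable (BottomHook? s t c) λ ¬hc → 1+n≢0 (trans (sym (extendedLabel-off ¬hc)) Lc≡0)

    block-bottom : ∀ {c} → BottomHook s t c → Blockᶠ s extendedLabel (extendedLabel c) ≐ BottomHook s t
    block-bottom hc =
      (λ (_ , Ld≡Lc) → extendedLabel≡0⇒bottom (trans Ld≡Lc (extendedLabel-bottom hc))) ,
      (λ hd → proj₁ hd , trans (extendedLabel-bottom hd) (sym (extendedLabel-bottom hc)))

    block-off : ∀ {c} → InDiagramᶠ μ c → Blockᶠ s extendedLabel (extendedLabel c) ≐ hookOfᶠ R' c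
    block-off {c} c∈μ = off-block , λ (d∈μ , L'd≡L'c) →
      removed⊆diagram d∈μ ,
      trans (extendedLabel-off (removed-avoids-bottomHook d∈μ)) (trans (cong suc L'd≡L'c) (sym (extendedLabel-off ¬hc)))
      where
        ¬hc = removed-avoids-bottomHook c∈μ
        off-block : ∀ {d} → Blockᶠ s extendedLabel (extendedLabel c) d → hookOfᶠ R' c d
        off-block {d} (d∈ , Ld≡Lc) =
          diagram∖bottomHook⊆removed d∈ ¬hd ,
          suc-injective (trans (sym (extendedLabel-off ¬hd)) (trans Ld≡Lc (extendedLabel-off ¬hc)))
          where
            ¬hd : ¬ BottomHook s t d
            ¬hd hd = 1+n≢0 (trans (sym (extendedLabel-off ¬hc)) (trans (sym Ld≡Lc) (extendedLabel-bottom hd)))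

    extend : SRTᶠ s
    extend = record { labelᶠ = extendedLabel ; hooksᶠ = extended-hooks }
      where
        extended-hooks : ∀ c → InDiagramᶠ s c →
                IsRimHook (Blockᶠ s extendedLabel (extendedLabel c)) ×
                Σ ℕ (λ r → Blockᶠ s extendedLabel (extendedLabel c) (r , 1))
        extended-hooks c c∈ = by-cases (BottomHook? s t c)
          where
            by-cases : Dec (BottomHook s t c) →
                       IsRimHook (Blockᶠ s extendedLabel (extendedLabel c)) ×
                       Σ ℕ (λ r → Blockᶠ s extendedLabel (extendedLabel c) (r , 1))
            by-cases (yes hc) =
              IsRimHook-resp-≐ (≐-sym (block-bottom hc)) (BottomHookIsRimHook.rimHook sh 1≤sn 1≤t t≤n) ,
              suc n' , proj₂ (block-bottom hc) (corner∈bottomHook hc)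
              where 1≤sn = proj₂ (proj₂ (proj₁ (corner∈bottomHook hc)))
            by-cases (no ¬hc) =
              IsRimHook-resp-≐ (≐-sym (block-off c∈μ)) (proj₁ (hooksᶠ R' c c∈μ)) ,
              proj₁ (proj₂ (hooksᶠ R' c c∈μ)) , proj₂ (block-off c∈μ) (proj₂ (proj₂ (hooksᶠ R' c c∈μ)))
              where c∈μ = diagram∖bottomHook⊆removed c∈ ¬hc

  surjective : ∀ {σ σ'} → Deletion t (suc n') σ σ' → IsPerm n' σ' → NonNegΔᶠ s (suc n') σ →
               Σ (SRTᶠ s) λ R → PermSRTᶠ (suc n') R σ
  surjective {σ} {σ'} del isPerm' nonNeg = extend , ρ.perm-lift del (IH.initial-on-diagonals R') perm'
    where
      R' = proj₁ (IH.surjective σ' isPerm' (NonNegΔ-lower del nonNeg))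
      perm' = proj₂ (IH.surjective σ' isPerm' (NonNegΔ-lower del nonNeg))
      open Extension R'
      module ρ = Restriction sh 1≤t t≤n below-t-nonempty extend R' block-bottom block-off

no-cells : ∀ {s} → Shape s 0 → ∀ {c} → ¬ InDiagramᶠ s c
no-cells sh c∈ = <⇒≱ (proj₁ c∈) (row≤bound sh c∈)

empty-correspondence : ∀ {s} → Shape s 0 → Correspondence s 0
empty-correspondence sh = record
  { encode = λ R → [] , record { isPerm = ↭-refl ; perm = no-rows ; nonNeg = no-rows ; gamma = no-rows }
  ; initial-on-diagonals = λ R c c∈ _ → ⊥-elim (no-cells sh c∈)
  ; has-terminal = λ R c c∈ → ⊥-elim (no-cells sh c∈)
  ; injective = λ R R' σ _ _ c d c∈ _ → ⊥-elim (no-cells sh c∈)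
  ; surjective = λ σ _ _ → record { labelᶠ = λ _ → 0 ; hooksᶠ = λ c c∈ → ⊥-elim (no-cells sh c∈) } , no-rows
  }
  where
    no-rows : ∀ {P : ℕ → Set} i → 1 ≤ i → i ≤ 0 → P i
    no-rows i 1≤i i≤0 = ⊥-elim (<⇒≱ 1≤i i≤0)

-- Δ_n = σ_n - n ≥ 0, while the entries after position t < n are those of σ', all < n.
empty-last⇒entry-last : ∀ {s n' t σ σ'} → s (suc n') ≡ 0 → 1 ≤ t → t ≤ suc n' →
                        Deletion t (suc n') σ σ' → IsPerm n' σ' → NonNegΔᶠ s (suc n') σ → t ≡ suc n'
empty-last⇒entry-last {s} {n'} {t} {σ} sn≡0 1≤t t≤n del isPerm' nonNeg with m≤n⇒m<n∨m≡n t≤n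
... | inj₂ t≡n = t≡n
... | inj₁ (s≤s t≤n') =
  ⊥-elim (1+n≰n (≤-trans n≤σn (≤-trans (≤-reflexive (sym (Deletion.after del t≤n')))
                                        (IsPerm-‼≤ isPerm' (≤-trans 1≤t t≤n') ≤-refl))))
  where
    n≤σn : suc n' ≤ σ ‼ suc n'
    n≤σn = subst (λ a → suc n' ≤ a + σ ‼ suc n') sn≡0
                 (0≤[a+x]-i⇒i≤a+x (s (suc n')) (σ ‼ suc n') (suc n') (nonNeg (suc n') (s≤s z≤n) ≤-refl))

record ValidTop (s : ℕ → ℕ) (n t : ℕ) : Set where
  field
    1≤t : 1 ≤ t
    t≤n : t ≤ n
    below-t-nonempty : ∀ {i} → t < i → i ≤ n → 1 ≤ s i

record BottomOf {s : ℕ → ℕ} (n : ℕ) (R : SRTᶠ s) : Set where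
  field
    top : ℕ
    valid : ValidTop s n top
    bottom : IsHookOf R (BottomHook s top)

correspondence : ∀ n {s} → Shape s n → Correspondence s n
correspondence zero sh = empty-correspondence sh
correspondence (suc n') {s} sh = record
  { encode = λ R → proj₁ (encode R)
  ; initial-on-diagonals = λ R → proj₁ (proj₂ (encode R))
  ; has-terminal = λ R → proj₂ (proj₂ (encode R))
  ; injective = injective
  ; surjective = surjective
  }
  where
    n : ℕ
    n = suc n'

    module StepAt {t} (v : ValidTop s n t) =
      Step sh (ValidTop.1≤t v) (ValidTop.t≤n v) (ValidTop.below-t-nonempty v)
           (correspondence n' (removeBottomHook-shape sh (ValidTop.1≤t v) (ValidTop.t≤n v)))

    nonempty-below : 1 ≤ s n → ∀ {t i} → t < i → i ≤ n → 1 ≤ s i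
    nonempty-below 1≤sn t<i i≤n = ≤-trans 1≤sn (antitone sh (≤-trans (s≤s z≤n) t<i) i≤n)

    bottom-of : (R : SRTᶠ s) → BottomOf n R
    bottom-of R with s n ≟ 0
    ... | yes sn≡0 = record
      { top = n
      ; valid = record { 1≤t = s≤s z≤n ; t≤n = ≤-refl ; below-t-nonempty = λ n<i i≤n → ⊥-elim (<⇒≱ n<i i≤n) }
      ; bottom = λ hc → ⊥-elim (empty-top⇒no-bottomHook sh (s≤s z≤n) sn≡0 hc) }
    ... | no sn≢0 = record
      { top = proj₁ found
      ; valid = record { 1≤t = proj₁ (proj₂ found) ; t≤n = proj₁ (proj₂ (proj₂ found))
                       ; below-t-nonempty = nonempty-below (n≢0⇒n>0 sn≢0) }
      ; bottom = proj₂ (proj₂ (proj₂ found)) }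
      where found = bottomHook-isHook sh (n≢0⇒n>0 sn≢0) R

    encode : (R : SRTᶠ s) → Σ (List ℕ) (Encoding n R) × InitialCellsOnDiagonals n R × HooksHaveTerminal R
    encode R = StepAt.encode valid R bottom
      where open BottomOf (bottom-of R)

    injective : ∀ (R₁ R₂ : SRTᶠ s) σ → PermSRTᶠ n R₁ σ → PermSRTᶠ n R₂ σ → SamePartitionᶠ R₁ R₂
    injective R₁ R₂ σ perm₁ perm₂ =
      StepAt.injective B₁.valid R₁ R₂ B₁.bottom (subst (λ t → IsHookOf R₂ (BottomHook s t)) t₂≡t₁ B₂.bottom)
                       σ perm₁ perm₂
      where
        module B₁ = BottomOf (bottom-of R₁)
        module B₂ = BottomOf (bottom-of R₂)
        t₂≡t₁ : B₂.top ≡ B₁.top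
        t₂≡t₁ = StepAt.perm-entry-n⇒top B₁.valid R₁ B₁.bottom {σ} perm₁
                  (ValidTop.1≤t B₂.valid) (ValidTop.t≤n B₂.valid)
                  (StepAt.perm-top-entry B₂.valid R₂ B₂.bottom {σ} perm₂)

    surjective : ∀ σ → IsPerm n σ → NonNegΔᶠ s n σ → Σ (SRTᶠ s) λ R → PermSRTᶠ n R σ
    surjective σ isPerm nonNeg with IsPerm-delete isPerm
    ... | xs , ys , refl , isPerm' = StepAt.surjective valid del isPerm' nonNeg
      where
        del = deletion-++ n xs ys
        t≤n : suc (length xs) ≤ n
        t≤n = s≤s (≤-trans (m≤m+n _ _) (≤-reflexive (trans (sym (length-++ xs)) (IsPerm-length isPerm'))))
        valid : ValidTop s n (suc (length xs))
        valid with s n ≟ 0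
        ... | no sn≢0 = record { 1≤t = s≤s z≤n ; t≤n = t≤n ; below-t-nonempty = nonempty-below (n≢0⇒n>0 sn≢0) }
        ... | yes sn≡0 = record
          { 1≤t = s≤s z≤n ; t≤n = t≤n
          ; below-t-nonempty = λ {i} t<i i≤n →
              ⊥-elim (<⇒≱ (subst (_< i) (empty-last⇒entry-last {s} sn≡0 (s≤s z≤n) t≤n del isPerm' nonNeg) t<i) i≤n) }

theorem6p14 : (la : List ℕ) → IsPartition la →
    ((R : SRT la) → Σ (List ℕ) (λ σ →
        IsPerm (length la) σ × PermSRT R σ × NonNegΔ la σ ×
        (∀ i → 1 ≤ i → i ≤ length la → GammaIs R i (Δ la σ i))))
    × (∀ (R R' : SRT la) (σ : List ℕ) → PermSRT R σ → PermSRT R' σ → SamePartition R R')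
    × (∀ (σ : List ℕ) → IsPerm (length la) σ → NonNegΔ la σ → Σ (SRT la) (λ R → PermSRT R σ))
theorem6p14 la is-partition =
  (λ R → let (σ , e) = encode (toSRTᶠ R) in σ , isPerm e , perm e , nonNeg e , gamma e) ,
  (λ R R' σ → injective (toSRTᶠ R) (toSRTᶠ R') σ) ,
  (λ σ isPerm nonNeg → let (R , perm) = surjective σ isPerm nonNeg in fromSRTᶠ R , perm)
  where
    open Correspondence (correspondence (length la) (partition-shape is-partition))
    open Encoding
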